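{- Let $n,c,i,l,m$ be integers with $l\geq\max\{0,n\}$, $i\geq\max\{1,n+1\}$, $1\leq m\leq c-1$ and $n+c-m-1\geq0$. Then $$\sum_{k=0}^{c-m-1}(-1)^k(c-k)\binom{c-m-1+i}{k}\binom{c-m-2+i-k}{i-(n+1)}\binom{l+c-m-1-k}{l}=\begin{cases}C_1+C_2 & \text{if } i\leq l,\\ C_1+C_2+(-1)^{n+c-m-1+l}(m+1-i)\binom{i-1}{l} & \text{if } l\leq i-1,\end{cases}$$ where $$C_1=\sum_{j=0}^{m_1}(-1)^jc\binom{c-m-1+i}{i-(n+1+j)}\binom{l-(n+1+j)}{l-(n+c-m+j)},\qquad C_2=\sum_{j=0}^{m_2}(-1)^j(n+c-m+j)\binom{c-m-1+i}{i-(n+1+j)}\binom{l-(n+1+j)}{l-(n+c-m-1+j)},$$ with $m_1=\min\{i-(n+1),l-(n+c-m)\}$ and $m_2=\min\{i-(n+1),l-(n+c-m-1)\}$. Further, $C_1=0$ if $l<n+c-m$ and $C_2=0$ if $l<n+c-m-1$.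
   Context: Binomial convention: for $N\in\mathbb{Z}_{\geq0}$ and $k\in\mathbb{Z}$, $\binom Nk=0$ if $k<0$ or $k>N$, and the usual binomial coefficient otherwise; moreover $\binom{ -1}{0}=1$. Sums with upper limit smaller than the lower limit are empty (zero). -}

module Defs where

open import Data.Nat as ℕ using (ℕ; zero; suc)
open import Data.Nat.Combinatorics using (_C_)
open import Data.Integer using (ℤ; +_; -[1+_]; _+_; _-_; _*_; -_; ∣_∣; _⊓_)

-- Binomial coefficient with integer arguments, following the paper's convention:
-- for N ≥ 0: binom N k = 0 if k < 0 or k > N, else the usual coefficient;
-- binom (-1) 0 = 1.  (Other negative tops never occur in the statement; we set them to 0.)
binom : ℤ → ℤ → ℤ
binom (+ N) (+ k) = + (N C k)
binom (+ N) -[1+ _ ] = + 0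
binom -[1+ zero ] (+ zero) = + 1
binom -[1+ _ ] _ = + 0

-- (-1)^e (depends only on parity of e)
pow-1ℕ : ℕ → ℤ
pow-1ℕ zero = + 1
pow-1ℕ (suc e) = - pow-1ℕ e

sgn : ℤ → ℤ
sgn e = pow-1ℕ ∣ e ∣

sumℕ : ℕ → (ℤ → ℤ) → ℤ
sumℕ zero f = + 0
sumℕ (suc n) f = sumℕ n f + f (+ n)

sum0to : ℤ → (ℤ → ℤ) → ℤ
sum0to (+ u) f = sumℕ (suc u) f
sum0to -[1+ _ ] f = + 0

LHS : ℤ → ℤ → ℤ → ℤ → ℤ → ℤ
LHS n c i l m = sum0to (c - m - + 1) λ k →
  sgn k * (c - k) * binom (c - m - + 1 + i) k
    * binom (c - m - + 2 + i - k) (i - (n + + 1))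
    * binom (l + c - m - + 1 - k) l

m₁ m₂ : ℤ → ℤ → ℤ → ℤ → ℤ → ℤ
m₁ n c i l m = (i - (n + + 1)) ⊓ (l - (n + c - m))
m₂ n c i l m = (i - (n + + 1)) ⊓ (l - (n + c - m - + 1))

C₁ : ℤ → ℤ → ℤ → ℤ → ℤ → ℤ
C₁ n c i l m = sum0to (m₁ n c i l m) λ j →
  sgn j * c * binom (c - m - + 1 + i) (i - (n + + 1 + j))
    * binom (l - (n + + 1 + j)) (l - (n + c - m + j))

C₂ : ℤ → ℤ → ℤ → ℤ → ℤ → ℤ
C₂ n c i l m = sum0to (m₂ n c i l m) λ j →
  sgn j * (n + c - m + j) * binom (c - m - + 1 + i) (i - (n + + 1 + j))
    * binom (l - (n + + 1 + j)) (l - (n + c - m - + 1 + j))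

module Submission where

-- Put a = c-m-1, e = n+a, p = i-(n+1), d = l-n and M = c-m-1+i = e+1+p, and write
-- C(x,k) for the binomial coefficient with integer upper index x.  Split c-k as
-- (m+1) + (a-k) and absorb the factor a-k into C(l+a-k, l).  Expanding
-- C(M-1-k, p) as the alternating sum of the C(M-k, r), r ≤ p, trading C(M,k) C(M-k,r)
-- for C(M,r) C(M-r,k) and summing over k with Vandermonde's convolution (upper
-- index -(l+1), resp. -(l+2)) turns the left-hand side into
--   ∑_{j ≤ p} (-1)^j C(M,p-j) ((m+1) C(d-1-j, a) + (l+1) C(d-1-j, a-1)).
-- For j < d the upper index d-1-j is a natural number, and a C(x,a) = (x+1-a) C(x,a-1)
-- turns the j-th summand into the j-th summands of C₁ and C₂.  The summands with
-- j ≥ d, present only when l ≤ i-1, are two further Vandermonde convolutions and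
-- add up to (-1)^(e+l) (m+1-i) C(i-1,l).  The last two claims hold because the
-- summation range of C₁, resp. C₂, is then empty.

module BinomialCoefficients where

  open import Data.Nat
  open import Data.Nat.Properties
  open import Data.Nat.Combinatorics
  open import Data.Nat.DivMod using (m/n*n≡m)
  open import Data.Nat.Tactic.RingSolver using (solve-∀)
  open import Algebra.Properties.CommutativeSemigroup *-commutativeSemigroup using (x∙yz≈y∙xz)
  open import Relation.Nullary using (yes; no)
  open import Relation.Binary.PropositionalEquality
  open ≡-Reasoning

  nCk*[k!*[n∸k]!]≡n! : ∀ {n k} → k ≤ n → (n C k) * (k ! * (n ∸ k) !) ≡ n !
  nCk*[k!*[n∸k]!]≡n! {n} {k} k≤n =
    trans (cong (_* (k ! * (n ∸ k) !)) (nCk≡n!/k![n-k]! k≤n)) (m/n*n≡m (k![n∸k]!∣n! k≤n))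
    where instance _ = k !* (n ∸ k) !≢0

  [x+y]Cx≡[x+y]Cy : ∀ x y → (x + y) C x ≡ (x + y) C y
  [x+y]Cx≡[x+y]Cy x y = trans (nCk≡nC[n∸k] (m≤m+n x y)) (cong ((x + y) C_) (m+n∸m≡n x y))

  [1+k]*[1+n]C[1+k]≡[1+n]*nCk : ∀ n k → suc k * (suc n C suc k) ≡ suc n * (n C k)
  [1+k]*[1+n]C[1+k]≡[1+n]*nCk n k with k ≤? n
  ... | no k≰n = begin
    suc k * (suc n C suc k) ≡⟨ cong (suc k *_) (k>n⇒nCk≡0 (s≤s (≰⇒> k≰n))) ⟩
    suc k * 0               ≡⟨ *-zeroʳ (suc k) ⟩
    0                       ≡⟨ *-zeroʳ (suc n) ⟨
    suc n * 0               ≡⟨ cong (suc n *_) (k>n⇒nCk≡0 (≰⇒> k≰n)) ⟨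
    suc n * (n C k)         ∎
  ... | yes k≤n = *-cancelʳ-≡ _ _ (k ! * (n ∸ k) !) (begin
    suc k * (suc n C suc k) * (k ! * (n ∸ k) !) ≡⟨ rearrange (suc k) (suc n C suc k) (k !) ((n ∸ k) !) ⟩
    (suc n C suc k) * (suc k ! * (n ∸ k) !)     ≡⟨ nCk*[k!*[n∸k]!]≡n! (s≤s k≤n) ⟩
    suc n * n !                                 ≡⟨ cong (suc n *_) (nCk*[k!*[n∸k]!]≡n! k≤n) ⟨
    suc n * ((n C k) * (k ! * (n ∸ k) !))       ≡⟨ *-assoc (suc n) (n C k) (k ! * (n ∸ k) !) ⟨
    suc n * (n C k) * (k ! * (n ∸ k) !)         ∎)
    where
    instance _ = k !* (n ∸ k) !≢0
    rearrange : ∀ a b c d → a * b * (c * d) ≡ b * (a * c * d)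
    rearrange = solve-∀

  [1+k]*nC[1+k]+k*nCk≡n*nCk : ∀ n k → suc k * (n C suc k) + k * (n C k) ≡ n * (n C k)
  [1+k]*nC[1+k]+k*nCk≡n*nCk zero    zero    = refl
  [1+k]*nC[1+k]+k*nCk≡n*nCk zero    (suc k) = cong₂ _+_ (*-zeroʳ (suc (suc k))) (*-zeroʳ (suc k))
  [1+k]*nC[1+k]+k*nCk≡n*nCk (suc n) zero    =
    trans (cong (λ z → 1 * z + 0) (nC1≡n (suc n))) (trans (+-identityʳ (1 * suc n)) (*-comm 1 (suc n)))
  [1+k]*nC[1+k]+k*nCk≡n*nCk (suc n) (suc k) = begin
    suc (suc k) * (suc n C suc (suc k)) + suc k * (suc n C suc k)
      ≡⟨ cong₂ _+_ ([1+k]*[1+n]C[1+k]≡[1+n]*nCk n (suc k)) ([1+k]*[1+n]C[1+k]≡[1+n]*nCk n k) ⟩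
    suc n * (n C suc k) + suc n * (n C k)
      ≡⟨ trans (*-distribˡ-+ (suc n) (n C k) (n C suc k)) (+-comm (suc n * (n C k)) (suc n * (n C suc k))) ⟨
    suc n * ((n C k) + (n C suc k))
      ≡⟨ cong (suc n *_) (nCk+nC[k+1]≡[n+1]C[k+1] n k) ⟩
    suc n * (suc n C suc k) ∎

  [1+l]*nCk≡[1+k]*nC[1+k]+s*nCk : ∀ {n k l} s → s + n ≡ l + suc k →
                                   suc l * (n C k) ≡ suc k * (n C suc k) + s * (n C k)
  [1+l]*nCk≡[1+k]*nC[1+k]+s*nCk {n} {k} {l} s s+n≡l+1+k = +-cancelʳ-≡ (k * (n C k)) _ _ (begin
    suc l * (n C k) + k * (n C k)                         ≡⟨ *-distribʳ-+ (n C k) (suc l) k ⟨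
    (suc l + k) * (n C k)                                 ≡⟨ cong (_* (n C k)) (trans (sym (+-suc l k)) (sym s+n≡l+1+k)) ⟩
    (s + n) * (n C k)                                     ≡⟨ *-distribʳ-+ (n C k) s n ⟩
    s * (n C k) + n * (n C k)                             ≡⟨ cong (s * (n C k) +_) ([1+k]*nC[1+k]+k*nCk≡n*nCk n k) ⟨
    s * (n C k) + (suc k * (n C suc k) + k * (n C k))     ≡⟨ regroup (s * (n C k)) (suc k * (n C suc k)) (k * (n C k)) ⟩
    suc k * (n C suc k) + s * (n C k) + k * (n C k)       ∎)
    where
    regroup : ∀ x y z → x + (y + z) ≡ y + x + z
    regroup = solve-∀

  private
    revision-vanishes : ∀ m k r → m < k + r → (m C k) * ((m ∸ k) C r) ≡ 0
    revision-vanishes m k r m<k+r with k ≤? m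
    ... | yes k≤m = trans (cong ((m C k) *_) (k>n⇒nCk≡0 m∸k<r)) (*-zeroʳ (m C k))
      where
      m∸k<r : m ∸ k < r
      m∸k<r = subst (m ∸ k <_) (m+n∸m≡n k r) (∸-monoˡ-< m<k+r k≤m)
    ... | no k≰m  = cong (_* ((m ∸ k) C r)) (k>n⇒nCk≡0 (≰⇒> k≰m))

  mCk*[m∸k]Cr≡mCr*[m∸r]Ck : ∀ m k r → (m C k) * ((m ∸ k) C r) ≡ (m C r) * ((m ∸ r) C k)
  mCk*[m∸k]Cr≡mCr*[m∸r]Ck m k r with (k + r) ≤? m
  ... | no k+r≰m = trans (revision-vanishes m k r (≰⇒> k+r≰m))
                         (sym (revision-vanishes m r k (subst (m <_) (+-comm k r) (≰⇒> k+r≰m))))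
  ... | yes k+r≤m = *-cancelʳ-≡ _ _ (k ! * (r ! * s !)) (begin
    (m C k) * ((m ∸ k) C r) * (k ! * (r ! * s !))  ≡⟨ factorials k r refl ⟩
    m !                                            ≡⟨ factorials r k (+-comm r k) ⟨
    (m C r) * ((m ∸ r) C k) * (r ! * (k ! * s !))  ≡⟨ cong ((m C r) * ((m ∸ r) C k) *_) (x∙yz≈y∙xz (r !) (k !) (s !)) ⟩
    (m C r) * ((m ∸ r) C k) * (k ! * (r ! * s !))  ∎)
    where
    s = m ∸ (k + r)
    instance _ = m*n≢0 (k !) (r ! * s !) {{k !≢0}} {{r !* s !≢0}}
    factorials : ∀ x y → x + y ≡ k + r → (m C x) * ((m ∸ x) C y) * (x ! * (y ! * s !)) ≡ m !
    factorials x y x+y≡k+r = begin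
      (m C x) * ((m ∸ x) C y) * (x ! * (y ! * s !))
        ≡⟨ regroup (m C x) ((m ∸ x) C y) (x !) (y !) (s !) ⟩
      (m C x) * (x ! * (((m ∸ x) C y) * (y ! * s !)))
        ≡⟨ cong (λ t → (m C x) * (x ! * (((m ∸ x) C y) * (y ! * t !)))) m∸x∸y≡s ⟨
      (m C x) * (x ! * (((m ∸ x) C y) * (y ! * (m ∸ x ∸ y) !)))
        ≡⟨ cong (λ t → (m C x) * (x ! * t)) (nCk*[k!*[n∸k]!]≡n! y≤m∸x) ⟩
      (m C x) * (x ! * (m ∸ x) !)
        ≡⟨ nCk*[k!*[n∸k]!]≡n! x≤m ⟩
      m ! ∎
      where
      x+y≤m : x + y ≤ m
      x+y≤m = subst (_≤ m) (sym x+y≡k+r) k+r≤m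
      x≤m : x ≤ m
      x≤m = m+n≤o⇒m≤o x x+y≤m
      y≤m∸x : y ≤ m ∸ x
      y≤m∸x = subst (_≤ m ∸ x) (m+n∸m≡n x y) (∸-monoˡ-≤ x x+y≤m)
      m∸x∸y≡s : m ∸ x ∸ y ≡ s
      m∸x∸y≡s = trans (∸-+-assoc m x y) (cong (m ∸_) x+y≡k+r)
      regroup : ∀ a b c d e → a * b * (c * (d * e)) ≡ a * (c * (b * (d * e)))
      regroup = solve-∀

open BinomialCoefficients

open import Data.Nat as ℕ using (ℕ; zero; suc; _∸_; z≤n; s≤s)
import Data.Nat.Properties as ℕ
import Data.Nat.Tactic.RingSolver as ℕ-Solver
open import Data.Nat.Combinatorics using (_C_; nCn≡1; nCk≡nC[n∸k]; k>n⇒nCk≡0; nCk+nC[k+1]≡[n+1]C[k+1])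
open import Data.Integer using (ℤ; +_; -[1+_]; 0ℤ; 1ℤ; _+_; _-_; _*_; -_; _⊓_; _⊔_; _≤_; _<_; ∣_∣; +<+; -<+)
open import Data.Integer.Properties
open import Data.Integer.Tactic.RingSolver using (solve-∀)
open import Algebra.Properties.CommutativeSemigroup *-commutativeSemigroup using (x∙yz≈y∙xz)
open import Data.Product using (_×_; _,_)
open import Data.Sum using (inj₁; inj₂)
open import Relation.Nullary using (yes; no; contradiction)
open import Relation.Binary.PropositionalEquality
open ≡-Reasoning
open import Defs

-- Finite sums

-- The body of ∑[ k < n ] extends over products but not over sums.
infix 6.5 ∑
∑ : ℕ → (ℕ → ℤ) → ℤ
∑ zero    f = 0ℤ
∑ (suc n) f = ∑ n f + f n

syntax ∑ n (λ k → e) = ∑[ k < n ] e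

∑-cong : ∀ n {f g : ℕ → ℤ} → (∀ {k} → k ℕ.< n → f k ≡ g k) → ∑ n f ≡ ∑ n g
∑-cong zero    f≗g = refl
∑-cong (suc n) f≗g = cong₂ _+_ (∑-cong n (λ k<n → f≗g (ℕ.m<n⇒m<1+n k<n))) (f≗g ℕ.≤-refl)

∑-0 : ∀ n → ∑[ k < n ] 0ℤ ≡ 0ℤ
∑-0 zero    = refl
∑-0 (suc n) = cong (_+ 0ℤ) (∑-0 n)

∑-distrib-+ : ∀ n (f g : ℕ → ℤ) → ∑[ k < n ] (f k + g k) ≡ ∑ n f + ∑ n g
∑-distrib-+ zero    f g = refl
∑-distrib-+ (suc n) f g = begin
  ∑[ k < n ] (f k + g k) + (f n + g n) ≡⟨ cong (_+ (f n + g n)) (∑-distrib-+ n f g) ⟩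
  ∑ n f + ∑ n g + (f n + g n)          ≡⟨ exchange (∑ n f) (∑ n g) (f n) (g n) ⟩
  ∑ n f + f n + (∑ n g + g n)          ∎
  where
  exchange : ∀ a b c d → a + b + (c + d) ≡ a + c + (b + d)
  exchange = solve-∀

∑-distribˡ-* : ∀ n x (f : ℕ → ℤ) → ∑[ k < n ] x * f k ≡ x * ∑ n f
∑-distribˡ-* zero    x f = sym (*-zeroʳ x)
∑-distribˡ-* (suc n) x f =
  trans (cong (_+ x * f n) (∑-distribˡ-* n x f)) (sym (*-distribˡ-+ x (∑ n f) (f n)))

∑-distribʳ-* : ∀ n x (f : ℕ → ℤ) → ∑[ k < n ] f k * x ≡ ∑ n f * x
∑-distribʳ-* n x f = begin
  ∑[ k < n ] f k * x   ≡⟨ ∑-cong n (λ {k} _ → *-comm (f k) x) ⟩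
  ∑[ k < n ] x * f k   ≡⟨ ∑-distribˡ-* n x f ⟩
  x * ∑ n f            ≡⟨ *-comm x (∑ n f) ⟩
  ∑ n f * x            ∎

∑-unfoldˡ : ∀ n (f : ℕ → ℤ) → ∑ (suc n) f ≡ f 0 + ∑[ k < n ] f (suc k)
∑-unfoldˡ zero    f = +-comm 0ℤ (f 0)
∑-unfoldˡ (suc n) f = trans (cong (_+ f (suc n)) (∑-unfoldˡ n f)) (+-assoc (f 0) _ _)

∑-split : ∀ m n (f : ℕ → ℤ) → ∑ (m ℕ.+ n) f ≡ ∑ m f + ∑[ k < n ] f (m ℕ.+ k)
∑-split m zero    f = trans (cong (λ z → ∑ z f) (ℕ.+-identityʳ m)) (sym (+-identityʳ (∑ m f)))
∑-split m (suc n) f = begin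
  ∑ (m ℕ.+ suc n) f                             ≡⟨ cong (λ z → ∑ z f) (ℕ.+-suc m n) ⟩
  ∑ (m ℕ.+ n) f + f (m ℕ.+ n)                   ≡⟨ cong (_+ f (m ℕ.+ n)) (∑-split m n f) ⟩
  ∑ m f + ∑[ k < n ] f (m ℕ.+ k) + f (m ℕ.+ n)  ≡⟨ +-assoc (∑ m f) _ _ ⟩
  ∑ m f + ∑[ k < suc n ] f (m ℕ.+ k)            ∎

∑-reverse : ∀ n (f : ℕ → ℤ) → ∑ (suc n) f ≡ ∑[ k < suc n ] f (n ∸ k)
∑-reverse zero    f = refl
∑-reverse (suc n) f = begin
  ∑ (suc n) f + f (suc n)                   ≡⟨ cong (_+ f (suc n)) (∑-reverse n f) ⟩
  ∑[ k < suc n ] f (n ∸ k) + f (suc n)      ≡⟨ +-comm _ (f (suc n)) ⟩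
  f (suc n) + ∑[ k < suc n ] f (n ∸ k)      ≡⟨ ∑-unfoldˡ (suc n) (λ k → f (suc n ∸ k)) ⟨
  ∑[ k < suc (suc n) ] f (suc n ∸ k)        ∎

∑-comm : ∀ m n (f : ℕ → ℕ → ℤ) → ∑[ i < m ] ∑ n (f i) ≡ ∑[ j < n ] ∑[ i < m ] f i j
∑-comm zero    n f = sym (∑-0 n)
∑-comm (suc m) n f = begin
  ∑[ i < m ] ∑ n (f i) + ∑ n (f m)          ≡⟨ cong (_+ ∑ n (f m)) (∑-comm m n f) ⟩
  ∑[ j < n ] ∑[ i < m ] f i j + ∑ n (f m)   ≡⟨ ∑-distrib-+ n _ (f m) ⟨
  ∑[ j < n ] ∑[ i < suc m ] f i j           ∎

pow-1ℕ-+ : ∀ m n → pow-1ℕ (m ℕ.+ n) ≡ pow-1ℕ m * pow-1ℕ n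
pow-1ℕ-+ zero    n = sym (*-identityˡ (pow-1ℕ n))
pow-1ℕ-+ (suc m) n = trans (cong -_ (pow-1ℕ-+ m n)) (neg-distribˡ-* (pow-1ℕ m) (pow-1ℕ n))

pow-1ℕ-square : ∀ n → pow-1ℕ n * pow-1ℕ n ≡ 1ℤ
pow-1ℕ-square zero    = refl
pow-1ℕ-square (suc n) = trans (neg-square (pow-1ℕ n)) (pow-1ℕ-square n)
  where
  neg-square : ∀ x → - x * - x ≡ x * x
  neg-square = solve-∀

pow-1ℕ-parity : ∀ {w x y z} → w ℕ.+ x ≡ y ℕ.+ z → pow-1ℕ (w ℕ.+ y) ≡ pow-1ℕ (x ℕ.+ z)
pow-1ℕ-parity {w} {x} {y} {z} w+x≡y+z = begin
  pow-1ℕ (w ℕ.+ y)                                              ≡⟨ *-identityʳ _ ⟨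
  pow-1ℕ (w ℕ.+ y) * 1ℤ                                         ≡⟨ cong (pow-1ℕ (w ℕ.+ y) *_) (pow-1ℕ-square (x ℕ.+ z)) ⟨
  pow-1ℕ (w ℕ.+ y) * (pow-1ℕ (x ℕ.+ z) * pow-1ℕ (x ℕ.+ z))      ≡⟨ *-assoc (pow-1ℕ (w ℕ.+ y)) _ _ ⟨
  pow-1ℕ (w ℕ.+ y) * pow-1ℕ (x ℕ.+ z) * pow-1ℕ (x ℕ.+ z)        ≡⟨ cong (_* pow-1ℕ (x ℕ.+ z)) (pow-1ℕ-+ (w ℕ.+ y) (x ℕ.+ z)) ⟨
  pow-1ℕ (w ℕ.+ y ℕ.+ (x ℕ.+ z)) * pow-1ℕ (x ℕ.+ z)             ≡⟨ cong (λ t → pow-1ℕ t * pow-1ℕ (x ℕ.+ z)) doubled ⟩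
  pow-1ℕ (y ℕ.+ z ℕ.+ (y ℕ.+ z)) * pow-1ℕ (x ℕ.+ z)             ≡⟨ cong (_* pow-1ℕ (x ℕ.+ z)) (trans (pow-1ℕ-+ (y ℕ.+ z) _) (pow-1ℕ-square (y ℕ.+ z))) ⟩
  1ℤ * pow-1ℕ (x ℕ.+ z)                                         ≡⟨ *-identityˡ _ ⟩
  pow-1ℕ (x ℕ.+ z)                                              ∎
  where
  doubled : w ℕ.+ y ℕ.+ (x ℕ.+ z) ≡ y ℕ.+ z ℕ.+ (y ℕ.+ z)
  doubled = trans (interchange w y x z) (cong (ℕ._+ (y ℕ.+ z)) w+x≡y+z)
    where
    interchange : ∀ w y x z → w ℕ.+ y ℕ.+ (x ℕ.+ z) ≡ w ℕ.+ x ℕ.+ (y ℕ.+ z)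
    interchange = ℕ-Solver.solve-∀

-- Binomial coefficients with an integer upper index

-[1+n]≡-n-1 : ∀ n → -[1+ n ] ≡ - + n - 1ℤ
-[1+n]≡-n-1 zero    = refl
-[1+n]≡-n-1 (suc n) = cong (λ z → -[1+ suc z ]) (sym (ℕ.+-identityʳ n))

m-n≡m∸n : ∀ {m n} → n ℕ.≤ m → + m - + n ≡ + (m ∸ n)
m-n≡m∸n {m} {n} n≤m = trans (m-n≡m⊖n m n) (⊖-≥ n≤m)

m+n-n≡m : ∀ m n → + (m ℕ.+ n) - + n ≡ + m
m+n-n≡m m n = trans (m-n≡m∸n (ℕ.m≤n+m n m)) (cong +_ (ℕ.m+n∸n≡m m n))

m-[1+n]≡-[1+n∸m] : ∀ {m n} → m ℕ.≤ n → + m - + suc n ≡ -[1+ (n ∸ m) ]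
m-[1+n]≡-[1+n∸m] {m} {n} m≤n =
  trans (m-n≡m⊖n m (suc n)) (trans (⊖-≤ (ℕ.m≤n⇒m≤1+n m≤n)) (cong (λ z → - + z) (ℕ.+-∸-assoc 1 m≤n)))

-- x(x-1)⋯(x-k+1)/k! for an integer x.
choose : ℤ → ℕ → ℤ
choose (+ n)     k = + (n C k)
choose -[1+ n ] k = pow-1ℕ k * + ((n ℕ.+ k) C k)

choose-zero : ∀ x → choose x 0 ≡ 1ℤ
choose-zero (+ n)     = refl
choose-zero -[1+ n ] = refl

choose-pascal : ∀ x k → choose (1ℤ + x) (suc k) ≡ choose x k + choose x (suc k)
choose-pascal (+ n) k = trans (cong +_ (sym (nCk+nC[k+1]≡[n+1]C[k+1] n k))) (pos-+ (n C k) (n C suc k))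
choose-pascal -[1+ zero ] k = begin
  0ℤ                                                         ≡⟨ cancel (pow-1ℕ k) ⟨
  pow-1ℕ k * 1ℤ + pow-1ℕ (suc k) * 1ℤ                        ≡⟨ cong₂ (λ x y → pow-1ℕ k * + x + pow-1ℕ (suc k) * + y) (nCn≡1 k) (nCn≡1 (suc k)) ⟨
  pow-1ℕ k * + (k C k) + pow-1ℕ (suc k) * + (suc k C suc k)  ∎
  where
  cancel : ∀ s → s * 1ℤ + - s * 1ℤ ≡ 0ℤ
  cancel = solve-∀
choose-pascal -[1+ suc t ] k = begin
  - pow-1ℕ k * + ((t ℕ.+ suc k) C suc k)
    ≡⟨ cong (λ z → - pow-1ℕ k * + (z C suc k)) (ℕ.+-suc t k) ⟩
  - pow-1ℕ k * + (suc s C suc k)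
    ≡⟨ regroup (pow-1ℕ k) (+ (suc s C k)) (+ (suc s C suc k)) ⟩
  pow-1ℕ k * + (suc s C k) + - pow-1ℕ k * (+ (suc s C k) + + (suc s C suc k))
    ≡⟨ cong (λ z → pow-1ℕ k * + (suc s C k) + - pow-1ℕ k * z) (pos-+ (suc s C k) (suc s C suc k)) ⟨
  pow-1ℕ k * + (suc s C k) + - pow-1ℕ k * + ((suc s C k) ℕ.+ (suc s C suc k))
    ≡⟨ cong (λ z → pow-1ℕ k * + (suc s C k) + - pow-1ℕ k * + z) (nCk+nC[k+1]≡[n+1]C[k+1] (suc s) k) ⟩
  pow-1ℕ k * + (suc s C k) + - pow-1ℕ k * + (suc (suc s) C suc k)
    ≡⟨ cong (λ z → pow-1ℕ k * + (suc s C k) + - pow-1ℕ k * + (suc z C suc k)) (ℕ.+-suc t k) ⟨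
  pow-1ℕ k * + (suc (t ℕ.+ k) C k) + - pow-1ℕ k * + ((suc t ℕ.+ suc k) C suc k) ∎
  where
  s = t ℕ.+ k
  regroup : ∀ σ x y → - σ * y ≡ σ * x + - σ * (x + y)
  regroup = solve-∀

choose-upper-negation : ∀ x k → pow-1ℕ k * choose x k ≡ choose (+ k - x - 1ℤ) k
choose-upper-negation -[1+ t ] k = begin
  pow-1ℕ k * (pow-1ℕ k * + ((t ℕ.+ k) C k)) ≡⟨ *-assoc (pow-1ℕ k) _ _ ⟨
  pow-1ℕ k * pow-1ℕ k * + ((t ℕ.+ k) C k)   ≡⟨ cong (_* + ((t ℕ.+ k) C k)) (pow-1ℕ-square k) ⟩
  1ℤ * + ((t ℕ.+ k) C k)                    ≡⟨ *-identityˡ _ ⟩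
  + ((t ℕ.+ k) C k)                         ≡⟨ cong (λ z → choose z k) top ⟨
  choose (+ k - -[1+ t ] - 1ℤ) k           ∎
  where
  top : + k - -[1+ t ] - 1ℤ ≡ + (t ℕ.+ k)
  top = begin
    + k - -[1+ t ] - 1ℤ         ≡⟨ cong (λ z → + k - z - 1ℤ) (-[1+n]≡-n-1 t) ⟩
    + k - (- + t - 1ℤ) - 1ℤ     ≡⟨ simplify (+ k) (+ t) ⟩
    + t + + k                   ≡⟨ pos-+ t k ⟨
    + (t ℕ.+ k)                 ∎
    where
    simplify : ∀ k t → k - (- t - 1ℤ) - 1ℤ ≡ t + k
    simplify = solve-∀
choose-upper-negation (+ n) k = trans (negate-natural k) (cong (λ z → choose z k) (k-[1+n]≡k-n-1 (+ k) (+ n)))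
  where
  k-[1+n]≡k-n-1 : ∀ k n → k - (1ℤ + n) ≡ k - n - 1ℤ
  k-[1+n]≡k-n-1 = solve-∀
  negate-natural : ∀ k → pow-1ℕ k * + (n C k) ≡ choose (+ k - + suc n) k
  negate-natural k with k ℕ.≤? n
  ... | yes k≤n = begin
    pow-1ℕ k * + (n C k)                ≡⟨ cong (λ z → pow-1ℕ k * + (z C k)) (ℕ.m∸n+n≡m k≤n) ⟨
    choose -[1+ (n ∸ k) ] k            ≡⟨ cong (λ z → choose z k) (m-[1+n]≡-[1+n∸m] k≤n) ⟨
    choose (+ k - + suc n) k            ∎
  ... | no k≰n = begin
    pow-1ℕ k * + (n C k)                ≡⟨ cong (λ z → pow-1ℕ k * + z) (k>n⇒nCk≡0 (ℕ.≰⇒> k≰n)) ⟩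
    pow-1ℕ k * 0ℤ                       ≡⟨ *-zeroʳ (pow-1ℕ k) ⟩
    0ℤ                                  ≡⟨ cong +_ (k>n⇒nCk≡0 (ℕ.∸-monoʳ-< (s≤s z≤n) (ℕ.≰⇒> k≰n))) ⟨
    + ((k ∸ suc n) C k)                 ≡⟨ cong (λ z → choose z k) (m-n≡m∸n (ℕ.≰⇒> k≰n)) ⟨
    choose (+ k - + suc n) k            ∎

choose-negative-sym : ∀ u a → pow-1ℕ u * choose -[1+ u ] a ≡ pow-1ℕ a * choose -[1+ a ] u
choose-negative-sym u a = begin
  pow-1ℕ u * (pow-1ℕ a * + ((u ℕ.+ a) C a)) ≡⟨ cong (λ z → pow-1ℕ u * (pow-1ℕ a * + z)) ([x+y]Cx≡[x+y]Cy u a) ⟨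
  pow-1ℕ u * (pow-1ℕ a * + ((u ℕ.+ a) C u)) ≡⟨ cong (λ z → pow-1ℕ u * (pow-1ℕ a * + (z C u))) (ℕ.+-comm u a) ⟩
  pow-1ℕ u * (pow-1ℕ a * + ((a ℕ.+ u) C u)) ≡⟨ x∙yz≈y∙xz (pow-1ℕ u) (pow-1ℕ a) _ ⟩
  pow-1ℕ a * (pow-1ℕ u * + ((a ℕ.+ u) C u)) ∎

choosePred : ℤ → ℕ → ℤ
choosePred x zero    = 0ℤ
choosePred x (suc k) = choose x k

-- Vandermonde's convolution

convolution : (ℕ → ℤ) → (ℕ → ℤ) → ℕ → ℤ
convolution f g n = ∑[ k < suc n ] f k * g (n ∸ k)

convolution-comm : ∀ f g n → convolution f g n ≡ convolution g f n
convolution-comm f g n = trans (∑-reverse n _) (∑-cong (suc n) λ {k} k<1+n →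
  trans (cong (λ z → f (n ∸ k) * g z) (ℕ.m∸[m∸n]≡n (ℕ.≤-pred k<1+n))) (*-comm (f (n ∸ k)) (g k)))

convolution-pascalˡ : ∀ {F f} g → F 0 ≡ f 0 → (∀ k → F (suc k) ≡ f k + f (suc k)) →
                      ∀ n → convolution F g (suc n) ≡ convolution f g n + convolution f g (suc n)
convolution-pascalˡ {F} {f} g F0≡f0 F[1+k]≡ n = begin
  convolution F g (suc n)
    ≡⟨ ∑-unfoldˡ (suc n) _ ⟩
  F 0 * g (suc n) + ∑[ k < suc n ] F (suc k) * g (n ∸ k)
    ≡⟨ cong₂ (λ x y → x * g (suc n) + y) F0≡f0 (∑-cong (suc n) λ {k} _ →
         trans (cong (_* g (n ∸ k)) (F[1+k]≡ k)) (*-distribʳ-+ (g (n ∸ k)) (f k) (f (suc k)))) ⟩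
  f 0 * g (suc n) + ∑[ k < suc n ] (f k * g (n ∸ k) + f (suc k) * g (n ∸ k))
    ≡⟨ cong (λ z → f 0 * g (suc n) + z) (∑-distrib-+ (suc n) _ _) ⟩
  f 0 * g (suc n) + (convolution f g n + ∑[ k < suc n ] f (suc k) * g (n ∸ k))
    ≡⟨ x+[y+z]≡y+[x+z] (f 0 * g (suc n)) (convolution f g n) (∑[ k < suc n ] f (suc k) * g (n ∸ k)) ⟩
  convolution f g n + (f 0 * g (suc n) + ∑[ k < suc n ] f (suc k) * g (n ∸ k))
    ≡⟨ cong (λ z → convolution f g n + z) (∑-unfoldˡ (suc n) _) ⟨
  convolution f g n + convolution f g (suc n) ∎
  where
  x+[y+z]≡y+[x+z] : ∀ x y z → x + (y + z) ≡ y + (x + z)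
  x+[y+z]≡y+[x+z] = solve-∀

vandermonde : ∀ m y n → convolution (choose (+ m)) (choose y) n ≡ choose (+ m + y) n
vandermonde zero y n = begin
  convolution (choose (+ 0)) (choose y) n        ≡⟨ ∑-unfoldˡ n _ ⟩
  1ℤ * choose y n + ∑[ k < n ] 0ℤ               ≡⟨ cong₂ _+_ (*-identityˡ (choose y n)) (∑-0 n) ⟩
  choose y n + 0ℤ                                ≡⟨ +-identityʳ (choose y n) ⟩
  choose y n                                     ≡⟨ cong (λ z → choose z n) (+-identityˡ y) ⟨
  choose (+ 0 + y) n                             ∎
vandermonde (suc m) y zero =
  trans (cong₂ (λ u v → 0ℤ + u * v) (choose-zero (+ suc m)) (choose-zero y)) (sym (choose-zero (+ suc m + y)))
vandermonde (suc m) y (suc n) = begin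
  convolution (choose (+ suc m)) (choose y) (suc n)
    ≡⟨ convolution-pascalˡ {choose (+ suc m)} {choose (+ m)} (choose y) refl (choose-pascal (+ m)) n ⟩
  convolution (choose (+ m)) (choose y) n + convolution (choose (+ m)) (choose y) (suc n)
    ≡⟨ cong₂ _+_ (vandermonde m y n) (vandermonde m y (suc n)) ⟩
  choose (+ m + y) n + choose (+ m + y) (suc n)
    ≡⟨ choose-pascal (+ m + y) n ⟨
  choose (1ℤ + (+ m + y)) (suc n)
    ≡⟨ cong (λ z → choose z (suc n)) (+-assoc 1ℤ (+ m) y) ⟨
  choose (+ suc m + y) (suc n) ∎

vandermondeʳ : ∀ m y n → ∑[ k < suc n ] + (m C (n ∸ k)) * choose y k ≡ choose (+ m + y) n
vandermondeʳ m y n = trans (∑-cong (suc n) λ {k} _ → *-comm (+ (m C (n ∸ k))) (choose y k))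
                           (trans (convolution-comm (choose y) (choose (+ m)) n) (vandermonde m y n))

∑-alternating-row : ∀ n p → ∑[ r < suc p ] pow-1ℕ (p ∸ r) * + (suc n C r) ≡ + (n C p)
∑-alternating-row n p = trans (∑-cong (suc p) λ {r} _ → term r) (vandermonde (suc n) -[1+ 0 ] p)
  where
  term : ∀ r → pow-1ℕ (p ∸ r) * + (suc n C r) ≡ choose (+ suc n) r * choose -[1+ 0 ] (p ∸ r)
  term r = begin
    pow-1ℕ (p ∸ r) * + (suc n C r)                            ≡⟨ *-comm (pow-1ℕ (p ∸ r)) _ ⟩
    + (suc n C r) * pow-1ℕ (p ∸ r)                            ≡⟨ cong (+ (suc n C r) *_) (*-identityʳ (pow-1ℕ (p ∸ r))) ⟨
    + (suc n C r) * (pow-1ℕ (p ∸ r) * 1ℤ)                     ≡⟨ cong (λ z → + (suc n C r) * (pow-1ℕ (p ∸ r) * + z)) (nCn≡1 (p ∸ r)) ⟨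
    + (suc n C r) * (pow-1ℕ (p ∸ r) * + ((p ∸ r) C (p ∸ r))) ∎

∑-alternating-vandermonde : ∀ Q L b →
  ∑[ k < suc b ] pow-1ℕ k * + (Q C k) * + ((L ℕ.+ (b ∸ k)) C L) ≡ choose (+ (b ℕ.+ L) - + Q) b
∑-alternating-vandermonde Q L b = begin
  ∑[ k < suc b ] pow-1ℕ k * + (Q C k) * + ((L ℕ.+ (b ∸ k)) C L)
    ≡⟨ ∑-cong (suc b) (λ k<1+b → term (ℕ.≤-pred k<1+b)) ⟩
  ∑[ k < suc b ] pow-1ℕ b * (choose (+ Q) k * choose -[1+ L ] (b ∸ k))
    ≡⟨ ∑-distribˡ-* (suc b) (pow-1ℕ b) _ ⟩
  pow-1ℕ b * convolution (choose (+ Q)) (choose -[1+ L ]) b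
    ≡⟨ cong (pow-1ℕ b *_) (vandermonde Q -[1+ L ] b) ⟩
  pow-1ℕ b * choose (+ Q + -[1+ L ]) b
    ≡⟨ choose-upper-negation (+ Q + -[1+ L ]) b ⟩
  choose (+ b - (+ Q + -[1+ L ]) - 1ℤ) b
    ≡⟨ cong (λ z → choose z b) top ⟩
  choose (+ (b ℕ.+ L) - + Q) b ∎
  where
  term : ∀ {k} → k ℕ.≤ b → pow-1ℕ k * + (Q C k) * + ((L ℕ.+ (b ∸ k)) C L)
                         ≡ pow-1ℕ b * (choose (+ Q) k * choose -[1+ L ] (b ∸ k))
  term {k} k≤b = begin
    pow-1ℕ k * + (Q C k) * + ((L ℕ.+ t) C L)
      ≡⟨ insert-square (pow-1ℕ t) (pow-1ℕ k) (+ (Q C k)) (+ ((L ℕ.+ t) C L)) (pow-1ℕ-square t) ⟩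
    pow-1ℕ t * pow-1ℕ k * (+ (Q C k) * (pow-1ℕ t * + ((L ℕ.+ t) C L)))
      ≡⟨ cong₂ (λ x y → x * (+ (Q C k) * (pow-1ℕ t * + y))) (sym (pow-1ℕ-+ t k)) ([x+y]Cx≡[x+y]Cy L t) ⟩
    pow-1ℕ (t ℕ.+ k) * (+ (Q C k) * (pow-1ℕ t * + ((L ℕ.+ t) C t)))
      ≡⟨ cong (λ z → pow-1ℕ z * (+ (Q C k) * (pow-1ℕ t * + ((L ℕ.+ t) C t)))) (ℕ.m∸n+n≡m k≤b) ⟩
    pow-1ℕ b * (+ (Q C k) * (pow-1ℕ t * + ((L ℕ.+ t) C t))) ∎
    where
    t = b ∸ k
    insert-square : ∀ s σ x y → s * s ≡ 1ℤ → σ * x * y ≡ s * σ * (x * (s * y))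
    insert-square s σ x y s²≡1 = begin
      σ * x * y                 ≡⟨ *-identityˡ (σ * x * y) ⟨
      1ℤ * (σ * x * y)          ≡⟨ cong (_* (σ * x * y)) s²≡1 ⟨
      s * s * (σ * x * y)       ≡⟨ rearrange s σ x y ⟩
      s * σ * (x * (s * y))     ∎
      where
      rearrange : ∀ s σ x y → s * s * (σ * x * y) ≡ s * σ * (x * (s * y))
      rearrange = solve-∀
  top : + b - (+ Q + -[1+ L ]) - 1ℤ ≡ + (b ℕ.+ L) - + Q
  top = begin
    + b - (+ Q + -[1+ L ]) - 1ℤ          ≡⟨ cong (λ z → + b - (+ Q + z) - 1ℤ) (-[1+n]≡-n-1 L) ⟩
    + b - (+ Q + (- + L - 1ℤ)) - 1ℤ      ≡⟨ simplify (+ b) (+ Q) (+ L) ⟩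
    + b + + L - + Q                      ≡⟨ cong (_- + Q) (pos-+ b L) ⟨
    + (b ℕ.+ L) - + Q                    ∎
    where
    simplify : ∀ b q l → b - (q + (- l - 1ℤ)) - 1ℤ ≡ b + l - q
    simplify = solve-∀

∑-alternating-revision : ∀ n p k (x : ℤ) → k ℕ.≤ n →
  pow-1ℕ k * + (suc n C k) * + ((n ∸ k) C p) * x
  ≡ ∑[ r < suc p ] pow-1ℕ (p ∸ r) * + (suc n C r) * (pow-1ℕ k * + ((suc n ∸ r) C k) * x)
∑-alternating-revision n p k x k≤n = begin
  pow-1ℕ k * + (suc n C k) * + ((n ∸ k) C p) * x
    ≡⟨ cong (λ z → pow-1ℕ k * + (suc n C k) * z * x) (∑-alternating-row (n ∸ k) p) ⟨
  pow-1ℕ k * + (suc n C k) * (∑[ r < suc p ] pow-1ℕ (p ∸ r) * + (suc (n ∸ k) C r)) * x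
    ≡⟨ cong (λ z → pow-1ℕ k * + (suc n C k) * (∑[ r < suc p ] pow-1ℕ (p ∸ r) * + (z C r)) * x) (ℕ.+-∸-assoc 1 k≤n) ⟨
  pow-1ℕ k * + (suc n C k) * (∑[ r < suc p ] pow-1ℕ (p ∸ r) * + ((suc n ∸ k) C r)) * x
    ≡⟨ cong (_* x) (∑-distribˡ-* (suc p) (pow-1ℕ k * + (suc n C k)) _) ⟨
  (∑[ r < suc p ] pow-1ℕ k * + (suc n C k) * (pow-1ℕ (p ∸ r) * + ((suc n ∸ k) C r))) * x
    ≡⟨ ∑-distribʳ-* (suc p) x _ ⟨
  ∑[ r < suc p ] pow-1ℕ k * + (suc n C k) * (pow-1ℕ (p ∸ r) * + ((suc n ∸ k) C r)) * x
    ≡⟨ ∑-cong (suc p) (λ {r} _ → regroup (pow-1ℕ k) (pow-1ℕ (p ∸ r)) x (revision r)) ⟩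
  ∑[ r < suc p ] pow-1ℕ (p ∸ r) * + (suc n C r) * (pow-1ℕ k * + ((suc n ∸ r) C k) * x) ∎
  where
  revision : ∀ r → + (suc n C k) * + ((suc n ∸ k) C r) ≡ + (suc n C r) * + ((suc n ∸ r) C k)
  revision r = trans (sym (pos-* (suc n C k) _)) (trans (cong +_ (mCk*[m∸k]Cr≡mCr*[m∸r]Ck (suc n) k r)) (pos-* (suc n C r) _))
  regroup : ∀ {w x y z} s t b → w * x ≡ y * z → s * w * (t * x) * b ≡ t * y * (s * z * b)
  regroup {w} {x} {y} {z} s t b wx≡yz = begin
    s * w * (t * x) * b   ≡⟨ pull s w t x b ⟩
    s * t * b * (w * x)   ≡⟨ cong (s * t * b *_) wx≡yz ⟩
    s * t * b * (y * z)   ≡⟨ push s t b y z ⟩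
    t * y * (s * z * b)   ∎
    where
    pull : ∀ s w t x b → s * w * (t * x) * b ≡ s * t * b * (w * x)
    pull = solve-∀
    push : ∀ s t b y z → s * t * b * (y * z) ≡ t * y * (s * z * b)
    push = solve-∀

∑-interchange : ∀ e p b L → b ℕ.≤ e ℕ.+ p →
  ∑[ k < suc b ] pow-1ℕ k * + (suc (e ℕ.+ p) C k) * + ((e ℕ.+ p ∸ k) C p) * + ((L ℕ.+ (b ∸ k)) C L)
  ≡ ∑[ j < suc p ] pow-1ℕ j * + (suc (e ℕ.+ p) C (p ∸ j)) * choose (+ (b ℕ.+ L) - + suc (e ℕ.+ j)) b
∑-interchange e p b L b≤e+p = begin
  ∑[ k < suc b ] pow-1ℕ k * + (M C k) * + ((e ℕ.+ p ∸ k) C p) * B k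
    ≡⟨ ∑-cong (suc b) (λ {k} k<1+b → ∑-alternating-revision (e ℕ.+ p) p k (B k) (ℕ.≤-trans (ℕ.≤-pred k<1+b) b≤e+p)) ⟩
  ∑[ k < suc b ] ∑[ r < suc p ] pow-1ℕ (p ∸ r) * + (M C r) * (pow-1ℕ k * + ((M ∸ r) C k) * B k)
    ≡⟨ ∑-comm (suc b) (suc p) _ ⟩
  ∑[ r < suc p ] ∑[ k < suc b ] pow-1ℕ (p ∸ r) * + (M C r) * (pow-1ℕ k * + ((M ∸ r) C k) * B k)
    ≡⟨ ∑-cong (suc p) (λ {r} _ → trans (∑-distribˡ-* (suc b) (pow-1ℕ (p ∸ r) * + (M C r)) _)
         (cong (pow-1ℕ (p ∸ r) * + (M C r) *_) (∑-alternating-vandermonde (M ∸ r) L b))) ⟩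
  ∑[ r < suc p ] pow-1ℕ (p ∸ r) * + (M C r) * choose (+ (b ℕ.+ L) - + (M ∸ r)) b
    ≡⟨ ∑-reverse p _ ⟩
  ∑[ j < suc p ] pow-1ℕ (p ∸ (p ∸ j)) * + (M C (p ∸ j)) * choose (+ (b ℕ.+ L) - + (M ∸ (p ∸ j))) b
    ≡⟨ ∑-cong (suc p) (λ {j} j<1+p → cong₂ (λ x y → pow-1ℕ x * + (M C (p ∸ j)) * choose (+ (b ℕ.+ L) - + y) b)
                                           (ℕ.m∸[m∸n]≡n (ℕ.≤-pred j<1+p)) (M∸[p∸j]≡1+e+j (ℕ.≤-pred j<1+p))) ⟩
  ∑[ j < suc p ] pow-1ℕ j * + (M C (p ∸ j)) * choose (+ (b ℕ.+ L) - + suc (e ℕ.+ j)) b ∎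
  where
  M = suc (e ℕ.+ p)
  B : ℕ → ℤ
  B k = + ((L ℕ.+ (b ∸ k)) C L)
  M∸[p∸j]≡1+e+j : ∀ {j} → j ℕ.≤ p → M ∸ (p ∸ j) ≡ suc (e ℕ.+ j)
  M∸[p∸j]≡1+e+j {j} j≤p = begin
    suc (e ℕ.+ p) ∸ (p ∸ j)   ≡⟨ ℕ.+-∸-assoc 1 (ℕ.≤-trans (ℕ.m∸n≤m p j) (ℕ.m≤n+m p e)) ⟩
    suc (e ℕ.+ p ∸ (p ∸ j))   ≡⟨ cong suc (ℕ.+-∸-assoc e (ℕ.m∸n≤m p j)) ⟩
    suc (e ℕ.+ (p ∸ (p ∸ j))) ≡⟨ cong (λ z → suc (e ℕ.+ z)) (ℕ.m∸[m∸n]≡n j≤p) ⟩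
    suc (e ℕ.+ j)             ∎

∑-interchange-pred : ∀ e p b l → b ℕ.≤ e ℕ.+ p →
  ∑[ k < b ] pow-1ℕ k * + (suc (e ℕ.+ p) C k) * + ((e ℕ.+ p ∸ k) C p) * + ((suc l ℕ.+ (b ∸ suc k)) C suc l)
  ≡ ∑[ j < suc p ] pow-1ℕ j * + (suc (e ℕ.+ p) C (p ∸ j)) * choosePred (+ (b ℕ.+ l) - + suc (e ℕ.+ j)) b
∑-interchange-pred e p zero    l _ =
  sym (trans (∑-cong (suc p) λ {j} _ → *-zeroʳ (pow-1ℕ j * + (suc (e ℕ.+ p) C (p ∸ j)))) (∑-0 (suc p)))
∑-interchange-pred e p (suc b) l 1+b≤e+p =
  trans (∑-interchange e p b (suc l) (ℕ.<⇒≤ 1+b≤e+p))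
        (∑-cong (suc p) λ {j} _ → cong (λ n → pow-1ℕ j * + (suc (e ℕ.+ p) C (p ∸ j)) * choose (+ n - + suc (e ℕ.+ j)) b)
                                      (ℕ.+-suc b l))

∑-lower-absorption : ∀ a l (f : ℕ → ℤ) →
  ∑[ k < suc a ] f k * + (a ∸ k) * + ((l ℕ.+ (a ∸ k)) C l)
  ≡ + suc l * (∑[ k < a ] f k * + ((suc l ℕ.+ (a ∸ suc k)) C suc l))
∑-lower-absorption a l f = begin
  ∑[ k < a ] f k * + (a ∸ k) * + ((l ℕ.+ (a ∸ k)) C l) + f a * + (a ∸ a) * + ((l ℕ.+ (a ∸ a)) C l)
    ≡⟨ cong₂ _+_ (∑-cong a (λ k<a → absorb (ℕ.+-∸-assoc 1 k<a)))
                 (cong (λ t → f a * + t * + ((l ℕ.+ t) C l)) (ℕ.n∸n≡0 a)) ⟩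
  ∑[ k < a ] + suc l * (f k * + ((suc l ℕ.+ (a ∸ suc k)) C suc l)) + f a * 0ℤ * + ((l ℕ.+ 0) C l)
    ≡⟨ cong₂ _+_ (∑-distribˡ-* a (+ suc l) _) (cong (_* + ((l ℕ.+ 0) C l)) (*-zeroʳ (f a))) ⟩
  + suc l * (∑[ k < a ] f k * + ((suc l ℕ.+ (a ∸ suc k)) C suc l)) + 0ℤ
    ≡⟨ +-identityʳ _ ⟩
  + suc l * (∑[ k < a ] f k * + ((suc l ℕ.+ (a ∸ suc k)) C suc l)) ∎
  where
  absorb : ∀ {k t} → a ∸ k ≡ suc t →
    f k * + (a ∸ k) * + ((l ℕ.+ (a ∸ k)) C l) ≡ + suc l * (f k * + ((suc l ℕ.+ t) C suc l))
  absorb {k} {t} a∸k≡1+t = begin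
    f k * + (a ∸ k) * + ((l ℕ.+ (a ∸ k)) C l)     ≡⟨ cong (λ s → f k * + s * + ((l ℕ.+ s) C l)) a∸k≡1+t ⟩
    f k * + suc t * + ((l ℕ.+ suc t) C l)         ≡⟨ cong (λ n → f k * + suc t * + (n C l)) (ℕ.+-suc l t) ⟩
    f k * + suc t * + ((suc l ℕ.+ t) C l)         ≡⟨ *-assoc (f k) _ _ ⟩
    f k * (+ suc t * + ((suc l ℕ.+ t) C l))       ≡⟨ cong (f k *_) (pos-* (suc t) _) ⟨
    f k * + (suc t ℕ.* ((suc l ℕ.+ t) C l))       ≡⟨ cong (λ z → f k * + z) lower-absorption ⟩
    f k * + (suc l ℕ.* ((suc l ℕ.+ t) C suc l))   ≡⟨ cong (f k *_) (pos-* (suc l) _) ⟩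
    f k * (+ suc l * + ((suc l ℕ.+ t) C suc l))   ≡⟨ x∙yz≈y∙xz (f k) (+ suc l) _ ⟩
    + suc l * (f k * + ((suc l ℕ.+ t) C suc l))   ∎
    where
    lower-absorption : suc t ℕ.* ((suc l ℕ.+ t) C l) ≡ suc l ℕ.* ((suc l ℕ.+ t) C suc l)
    lower-absorption = trans ([1+l]*nCk≡[1+k]*nC[1+k]+s*nCk 0 (ℕ.+-comm (suc l) t)) (ℕ.+-identityʳ _)

-- The binomial coefficients and truncated sums of the statement

binom-negativeʳ : ∀ x k → binom x -[1+ k ] ≡ 0ℤ
binom-negativeʳ (+ n)          k = refl
binom-negativeʳ -[1+ zero ]    k = refl
binom-negativeʳ -[1+ suc n ]   k = refl

binom-below : ∀ x {y} j → y < + j → binom x (y - + j) ≡ 0ℤ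
binom-below x {+ m} (suc j) (+<+ m<1+j) =
  trans (cong (binom x) (m-[1+n]≡-[1+n∸m] (ℕ.≤-pred m<1+j))) (binom-negativeʳ x _)
binom-below x { -[1+ m ]} zero    -<+ = binom-negativeʳ x m
binom-below x { -[1+ m ]} (suc j) -<+ = binom-negativeʳ x _

binom-sym : ∀ n k → binom (+ n) (+ n - + k) ≡ + (n C k)
binom-sym n k with k ℕ.≤? n
... | yes k≤n = trans (cong (binom (+ n)) (m-n≡m∸n k≤n)) (cong +_ (sym (nCk≡nC[n∸k] k≤n)))
binom-sym n (suc k) | no k≰n =
  trans (cong (binom (+ n)) (m-[1+n]≡-[1+n∸m] (ℕ.≤-pred (ℕ.≰⇒> k≰n))))
        (sym (cong +_ (k>n⇒nCk≡0 (ℕ.≰⇒> k≰n))))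
binom-sym n zero    | no 0≰n = contradiction z≤n 0≰n

sumℕ≡∑ : ∀ n f → sumℕ n f ≡ ∑[ k < n ] f (+ k)
sumℕ≡∑ zero    f = refl
sumℕ≡∑ (suc n) f = cong (_+ f (+ n)) (sumℕ≡∑ n f)

sum0to-negative : ∀ {y} f → y < 0ℤ → sum0to y f ≡ 0ℤ
sum0to-negative { -[1+ _ ]} f _ = refl
sum0to-negative {+ _} f (+<+ ())

sum0to-⊓ : ∀ p y f → (∀ j → y < + j → f (+ j) ≡ 0ℤ) → sum0to (+ p ⊓ y) f ≡ ∑[ j < suc p ] f (+ j)
sum0to-⊓ p -[1+ x ] f vanish = sym (trans (∑-cong (suc p) λ {j} _ → vanish j -<+) (∑-0 (suc p)))
sum0to-⊓ p (+ x) f vanish with ℕ.≤-total p x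
... | inj₁ p≤x = trans (cong (λ z → sumℕ (suc z) f) (ℕ.m≤n⇒m⊓n≡m p≤x)) (sumℕ≡∑ (suc p) f)
... | inj₂ x≤p = begin
  sumℕ (suc (p ℕ.⊓ x)) f                                   ≡⟨ cong (λ z → sumℕ (suc z) f) (ℕ.m≥n⇒m⊓n≡n x≤p) ⟩
  sumℕ (suc x) f                                           ≡⟨ sumℕ≡∑ (suc x) f ⟩
  ∑[ j < suc x ] f (+ j)                                    ≡⟨ +-identityʳ _ ⟨
  ∑[ j < suc x ] f (+ j) + 0ℤ                               ≡⟨ cong (λ z → ∑[ j < suc x ] f (+ j) + z) tail-vanishes ⟨
  ∑[ j < suc x ] f (+ j) + ∑[ k < p ∸ x ] f (+ (suc x ℕ.+ k)) ≡⟨ ∑-split (suc x) (p ∸ x) (λ j → f (+ j)) ⟨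
  ∑[ j < suc x ℕ.+ (p ∸ x) ] f (+ j)                        ≡⟨ cong (λ z → ∑[ j < suc z ] f (+ j)) (ℕ.m+[n∸m]≡n x≤p) ⟩
  ∑[ j < suc p ] f (+ j)                                    ∎
  where
  tail-vanishes : ∑[ k < p ∸ x ] f (+ (suc x ℕ.+ k)) ≡ 0ℤ
  tail-vanishes = trans (∑-cong (p ∸ x) λ {k} _ → vanish (suc x ℕ.+ k) (+<+ (s≤s (ℕ.m≤m+n x k)))) (∑-0 (p ∸ x))

sum0to-⊓-below : ∀ x {y z} f → y < z → sum0to (x ⊓ (y - z)) f ≡ 0ℤ
sum0to-⊓-below x {y} {z} f y<z = sum0to-negative f (≤-<-trans (i⊓j≤j x (y - z)) y-z<0)
  where
  y-z<0 : y - z < 0ℤ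
  y-z<0 = subst (y - z <_) (+-inverseʳ z) (+-monoˡ-< (- z) y<z)

choose-bracket-nonnegative : ∀ μ n a l s → s ℕ.+ n ≡ l ℕ.+ a →
  μ * choose (+ n) a + + suc l * choosePred (+ n) a
  ≡ (μ + + a) * binom (+ n) (+ n - + a) + + s * binom (+ n) (+ n - + a + 1ℤ)
choose-bracket-nonnegative μ n zero l s _ = begin
  μ * + (n C 0) + + suc l * 0ℤ                      ≡⟨ drop-zero μ (+ (n C 0)) (+ suc l) (+ s) ⟩
  (μ + 0ℤ) * + (n C 0) + + s * 0ℤ                   ≡⟨ cong₂ (λ x y → (μ + 0ℤ) * x + + s * y) (sym (binom-sym n 0)) n+1-overflow ⟩
  (μ + 0ℤ) * binom (+ n) (+ n - 0ℤ) + + s * binom (+ n) (+ n - 0ℤ + 1ℤ) ∎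
  where
  drop-zero : ∀ μ x l s → μ * x + l * 0ℤ ≡ (μ + 0ℤ) * x + s * 0ℤ
  drop-zero = solve-∀
  n+1-overflow : 0ℤ ≡ binom (+ n) (+ n - 0ℤ + 1ℤ)
  n+1-overflow = sym (trans (cong (binom (+ n)) (trans (cong (_+ 1ℤ) (+-identityʳ (+ n))) (pos-+ n 1)))
                            (cong +_ (k>n⇒nCk≡0 (ℕ.m<m+n n (s≤s z≤n)))))
choose-bracket-nonnegative μ n (suc a) l s s+n≡l+1+a = begin
  μ * + (n C suc a) + + suc l * + (n C a)
    ≡⟨ cong (λ z → μ * + (n C suc a) + z) (trans (sym (pos-* (suc l) (n C a))) (cong +_ ratio)) ⟩
  μ * + (n C suc a) + + (suc a ℕ.* (n C suc a) ℕ.+ s ℕ.* (n C a))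
    ≡⟨ cong (λ z → μ * + (n C suc a) + z) (trans (pos-+ (suc a ℕ.* (n C suc a)) (s ℕ.* (n C a))) (cong₂ _+_ (pos-* (suc a) (n C suc a)) (pos-* s (n C a)))) ⟩
  μ * + (n C suc a) + (+ suc a * + (n C suc a) + + s * + (n C a))
    ≡⟨ regroup μ (+ suc a) (+ (n C suc a)) (+ s) (+ (n C a)) ⟩
  (μ + + suc a) * + (n C suc a) + + s * + (n C a)
    ≡⟨ cong₂ (λ x y → (μ + + suc a) * x + + s * y) (binom-sym n (suc a)) (binom-sym n a) ⟨
  (μ + + suc a) * binom (+ n) (+ n - + suc a) + + s * binom (+ n) (+ n - + a)
    ≡⟨ cong (λ z → (μ + + suc a) * binom (+ n) (+ n - + suc a) + + s * binom (+ n) z) (n-a≡n-[1+a]+1 (+ n) (+ a)) ⟩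
  (μ + + suc a) * binom (+ n) (+ n - + suc a) + + s * binom (+ n) (+ n - + suc a + 1ℤ) ∎
  where
  ratio : suc l ℕ.* (n C a) ≡ suc a ℕ.* (n C suc a) ℕ.+ s ℕ.* (n C a)
  ratio = [1+l]*nCk≡[1+k]*nC[1+k]+s*nCk s s+n≡l+1+a
  regroup : ∀ μ a x s y → μ * x + (a * x + s * y) ≡ (μ + a) * x + s * y
  regroup = solve-∀
  n-a≡n-[1+a]+1 : ∀ n a → n - a ≡ n - (1ℤ + a) + 1ℤ
  n-a≡n-[1+a]+1 = solve-∀

choose-negative-shift : ∀ d u a → pow-1ℕ (d ℕ.+ u) * choose -[1+ u ] a ≡ pow-1ℕ (d ℕ.+ a) * choose -[1+ a ] u
choose-negative-shift d u a = begin
  pow-1ℕ (d ℕ.+ u) * choose -[1+ u ] a              ≡⟨ cong (_* choose -[1+ u ] a) (pow-1ℕ-+ d u) ⟩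
  pow-1ℕ d * pow-1ℕ u * choose -[1+ u ] a           ≡⟨ *-assoc (pow-1ℕ d) _ _ ⟩
  pow-1ℕ d * (pow-1ℕ u * choose -[1+ u ] a)         ≡⟨ cong (pow-1ℕ d *_) (choose-negative-sym u a) ⟩
  pow-1ℕ d * (pow-1ℕ a * choose -[1+ a ] u)         ≡⟨ *-assoc (pow-1ℕ d) _ _ ⟨
  pow-1ℕ d * pow-1ℕ a * choose -[1+ a ] u           ≡⟨ cong (_* choose -[1+ a ] u) (pow-1ℕ-+ d a) ⟨
  pow-1ℕ (d ℕ.+ a) * choose -[1+ a ] u              ∎

-[1+u]-a≡-[1+u+a] : ∀ u a → -[1+ u ] - + a ≡ -[1+ (u ℕ.+ a) ]
-[1+u]-a≡-[1+u+a] u zero    = trans (+-identityʳ -[1+ u ]) (cong -[1+_] (sym (ℕ.+-identityʳ u)))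
-[1+u]-a≡-[1+u+a] u (suc a) = cong -[1+_] (sym (ℕ.+-suc u a))

-- The convention binom (-1) 0 = 1 of the statement matters only here, for a = u = 0.
choosePred-negative : ∀ l d a u s → s ≡ suc (l ℕ.+ a ℕ.+ u) →
  pow-1ℕ (d ℕ.+ u) * (+ suc l * choosePred -[1+ u ] a)
  ≡ pow-1ℕ (d ℕ.+ u) * (+ s * binom -[1+ u ] (-[1+ u ] - + a + 1ℤ)) - pow-1ℕ (d ℕ.+ a) * (+ suc l * choose (- + a) u)
choosePred-negative l d zero zero _ refl = begin
  pow-1ℕ (d ℕ.+ 0) * (+ suc l * 0ℤ)                                            ≡⟨ cancel (pow-1ℕ (d ℕ.+ 0)) (+ suc l) ⟩
  pow-1ℕ (d ℕ.+ 0) * (+ suc l * 1ℤ) - pow-1ℕ (d ℕ.+ 0) * (+ suc l * 1ℤ)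
    ≡⟨ cong (λ n → pow-1ℕ (d ℕ.+ 0) * (+ suc n * 1ℤ) - pow-1ℕ (d ℕ.+ 0) * (+ suc l * 1ℤ))
            (trans (ℕ.+-identityʳ (l ℕ.+ 0)) (ℕ.+-identityʳ l)) ⟨
  pow-1ℕ (d ℕ.+ 0) * (+ suc (l ℕ.+ 0 ℕ.+ 0) * 1ℤ) - pow-1ℕ (d ℕ.+ 0) * (+ suc l * 1ℤ) ∎
  where
  cancel : ∀ σ ℓ → σ * (ℓ * 0ℤ) ≡ σ * (ℓ * 1ℤ) - σ * (ℓ * 1ℤ)
  cancel = solve-∀
choosePred-negative l d zero (suc u) _ refl =
  all-zero (pow-1ℕ (d ℕ.+ suc u)) (pow-1ℕ (d ℕ.+ 0)) (+ suc l) (+ suc (l ℕ.+ 0 ℕ.+ suc u))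
  where
  all-zero : ∀ σ τ ℓ s → σ * (ℓ * 0ℤ) ≡ σ * (s * 0ℤ) - τ * (ℓ * 0ℤ)
  all-zero = solve-∀
choosePred-negative l d (suc a) u _ refl = begin
  σ * (+ suc l * choose -[1+ u ] a)
    ≡⟨ x∙yz≈y∙xz σ (+ suc l) _ ⟩
  + suc l * (σ * choose -[1+ u ] a)
    ≡⟨ cong (+ suc l *_) (choose-negative-shift d u a) ⟩
  + suc l * (pow-1ℕ (d ℕ.+ a) * choose -[1+ a ] u)
    ≡⟨ reorder σ (pow-1ℕ (d ℕ.+ a)) (+ suc l) (+ s) (choose -[1+ a ] u) ⟩
  σ * (+ s * 0ℤ) - - pow-1ℕ (d ℕ.+ a) * (+ suc l * choose -[1+ a ] u)
    ≡⟨ cong₂ (λ x y → σ * (+ s * x) - y * (+ suc l * choose -[1+ a ] u)) B₂≡0 (cong pow-1ℕ (ℕ.+-suc d a)) ⟨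
  σ * (+ s * binom -[1+ u ] (-[1+ u ] - + suc a + 1ℤ)) - pow-1ℕ (d ℕ.+ suc a) * (+ suc l * choose -[1+ a ] u) ∎
  where
  σ = pow-1ℕ (d ℕ.+ u)
  s = suc (l ℕ.+ suc a ℕ.+ u)
  reorder : ∀ σ τ ℓ s y → ℓ * (τ * y) ≡ σ * (s * 0ℤ) - - τ * (ℓ * y)
  reorder = solve-∀
  B₂≡0 : binom -[1+ u ] (-[1+ u ] - + suc a + 1ℤ) ≡ 0ℤ
  B₂≡0 = trans (cong (binom -[1+ u ]) (trans (x-[1+a]+1≡x-a -[1+ u ] (+ a)) (-[1+u]-a≡-[1+u+a] u a)))
               (binom-negativeʳ -[1+ u ] _)
    where
    x-[1+a]+1≡x-a : ∀ x a → x - (1ℤ + a) + 1ℤ ≡ x - a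
    x-[1+a]+1≡x-a = solve-∀

choose-bracket-negative : ∀ μ u a l d s → s ≡ suc (l ℕ.+ a ℕ.+ u) →
  pow-1ℕ (d ℕ.+ u) * (μ * choose -[1+ u ] a + + suc l * choosePred -[1+ u ] a)
  ≡ pow-1ℕ (d ℕ.+ u) * ((μ + + a) * binom -[1+ u ] (-[1+ u ] - + a) + + s * binom -[1+ u ] (-[1+ u ] - + a + 1ℤ))
    + pow-1ℕ (d ℕ.+ a) * (μ * choose -[1+ a ] u - + suc l * choose (- + a) u)
choose-bracket-negative μ u a l d s s≡1+l+a+u = begin
  σ * (μ * X + ℓ * P)                              ≡⟨ split σ μ X ℓ P ⟩
  μ * (σ * X) + σ * (ℓ * P)                        ≡⟨ cong₂ _+_ (cong (μ *_) (choose-negative-shift d u a))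
                                                                (choosePred-negative l d a u s s≡1+l+a+u) ⟩
  μ * (τ * Y) + (σ * (+ s * B₂) - τ * (ℓ * G))     ≡⟨ merge σ τ μ Y (μ + + a) (+ s) B₂ ℓ G ⟩
  σ * ((μ + + a) * 0ℤ + + s * B₂) + τ * (μ * Y - ℓ * G)
    ≡⟨ cong (λ z → σ * ((μ + + a) * z + + s * B₂) + τ * (μ * Y - ℓ * G))
            (sym (trans (cong (binom -[1+ u ]) (-[1+u]-a≡-[1+u+a] u a)) (binom-negativeʳ -[1+ u ] _))) ⟩
  σ * ((μ + + a) * binom -[1+ u ] (-[1+ u ] - + a) + + s * B₂) + τ * (μ * Y - ℓ * G) ∎
  where
  σ = pow-1ℕ (d ℕ.+ u)
  τ = pow-1ℕ (d ℕ.+ a)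
  ℓ = + suc l
  X = choose -[1+ u ] a
  Y = choose -[1+ a ] u
  P = choosePred -[1+ u ] a
  G = choose (- + a) u
  B₂ = binom -[1+ u ] (-[1+ u ] - + a + 1ℤ)
  split : ∀ σ μ x ℓ p → σ * (μ * x + ℓ * p) ≡ μ * (σ * x) + σ * (ℓ * p)
  split = solve-∀
  merge : ∀ σ τ μ y c s b ℓ g → μ * (τ * y) + (σ * (s * b) - τ * (ℓ * g)) ≡ σ * (c * 0ℤ + s * b) + τ * (μ * y - ℓ * g)
  merge = solve-∀

-- In the notation of the statement a = c-m-1, e = n+c-m-1, p = i-(n+1), d = l-n and μ = m+1;
-- then M = c-m-1+i and top j = l-(n+1+j).
module Identity (e a p d l : ℕ) (μ : ℤ) (balance : e ℕ.+ d ≡ l ℕ.+ a) (a≤e+p : a ℕ.≤ e ℕ.+ p) where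

  M : ℕ
  M = suc (e ℕ.+ p)

  top : ℕ → ℤ
  top j = + d - + suc j

  lhsSummand : ℕ → ℤ
  lhsSummand k = pow-1ℕ k * (μ + + (a ∸ k)) * + (M C k) * + ((e ℕ.+ p ∸ k) C p) * + ((l ℕ.+ (a ∸ k)) C l)

  lhsTerm c₁Term c₂Term : ℕ → ℤ
  lhsTerm j = pow-1ℕ j * + (M C (p ∸ j)) * (μ * choose (top j) a + + suc l * choosePred (top j) a)
  c₁Term  j = pow-1ℕ j * (μ + + a) * + (M C (p ∸ j)) * binom (top j) (top j - + a)
  c₂Term  j = pow-1ℕ j * + suc (e ℕ.+ j) * + (M C (p ∸ j)) * binom (top j) (top j - + a + 1ℤ)

  τ : ℤ
  τ = pow-1ℕ (d ℕ.+ a)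

  extraTerm : ℕ → ℤ
  extraTerm u = τ * + (M C (p ∸ (d ℕ.+ u))) * (μ * choose -[1+ a ] u - + suc l * choose (- + a) u)

  ∑-lhsSummand : ∑ (suc a) lhsSummand ≡ ∑ (suc p) lhsTerm
  ∑-lhsSummand = begin
    ∑ (suc a) lhsSummand
      ≡⟨ ∑-cong (suc a) (λ {k} _ → split-μ (pow-1ℕ k) μ (+ (a ∸ k)) (+ (M C k)) (+ ((e ℕ.+ p ∸ k) C p)) _) ⟩
    ∑[ k < suc a ] (μ * w k + v k * + (a ∸ k) * + ((l ℕ.+ (a ∸ k)) C l))
      ≡⟨ ∑-distrib-+ (suc a) _ _ ⟩
    ∑[ k < suc a ] μ * w k + ∑[ k < suc a ] v k * + (a ∸ k) * + ((l ℕ.+ (a ∸ k)) C l)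
      ≡⟨ cong₂ _+_ (∑-distribˡ-* (suc a) μ w) (∑-lower-absorption a l v) ⟩
    μ * ∑ (suc a) w + + suc l * (∑[ k < a ] v k * + ((suc l ℕ.+ (a ∸ suc k)) C suc l))
      ≡⟨ cong₂ (λ x y → μ * x + + suc l * y) (∑-interchange e p a l a≤e+p) (∑-interchange-pred e p a l a≤e+p) ⟩
    μ * (∑[ j < suc p ] c j * choose (T j) a) + + suc l * (∑[ j < suc p ] c j * choosePred (T j) a)
      ≡⟨ cong₂ _+_ (∑-distribˡ-* (suc p) μ _) (∑-distribˡ-* (suc p) (+ suc l) _) ⟨
    ∑[ j < suc p ] μ * (c j * choose (T j) a) + ∑[ j < suc p ] + suc l * (c j * choosePred (T j) a)
      ≡⟨ ∑-distrib-+ (suc p) _ _ ⟨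
    ∑[ j < suc p ] (μ * (c j * choose (T j) a) + + suc l * (c j * choosePred (T j) a))
      ≡⟨ ∑-cong (suc p) (λ {j} _ → trans (factor (c j) μ _ (+ suc l) _)
                                         (cong (λ x → c j * (μ * choose x a + + suc l * choosePred x a)) (T≡top j))) ⟩
    ∑ (suc p) lhsTerm ∎
    where
    v w c : ℕ → ℤ
    v k = pow-1ℕ k * + (M C k) * + ((e ℕ.+ p ∸ k) C p)
    w k = v k * + ((l ℕ.+ (a ∸ k)) C l)
    c j = pow-1ℕ j * + (M C (p ∸ j))
    T : ℕ → ℤ
    T j = + (a ℕ.+ l) - + suc (e ℕ.+ j)
    split-μ : ∀ σ μ t x y z → σ * (μ + t) * x * y * z ≡ μ * (σ * x * y * z) + σ * x * y * t * z
    split-μ = solve-∀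
    factor : ∀ c μ x ℓ y → μ * (c * x) + ℓ * (c * y) ≡ c * (μ * x + ℓ * y)
    factor = solve-∀
    T≡top : ∀ j → T j ≡ top j
    T≡top j = begin
      + (a ℕ.+ l) - + suc (e ℕ.+ j)        ≡⟨ cong (λ n → + n - + suc (e ℕ.+ j)) (trans (ℕ.+-comm a l) (sym balance)) ⟩
      + (e ℕ.+ d) - + suc (e ℕ.+ j)        ≡⟨ cong₂ (λ x y → x - (1ℤ + y)) (pos-+ e d) (pos-+ e j) ⟩
      + e + + d - (1ℤ + (+ e + + j))       ≡⟨ cancel-e (+ e) (+ d) (+ j) ⟩
      + d - (1ℤ + + j)                     ∎
      where
      cancel-e : ∀ e d j → e + d - (1ℤ + (e + j)) ≡ d - (1ℤ + j)
      cancel-e = solve-∀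

  lhsTerm-below : ∀ {j} → j ℕ.< d → lhsTerm j ≡ c₁Term j + c₂Term j
  lhsTerm-below {j} j<d = begin
    σ * β * (μ * choose (top j) a + + suc l * choosePred (top j) a)
      ≡⟨ cong (λ x → σ * β * (μ * choose x a + + suc l * choosePred x a)) top≡N ⟩
    σ * β * (μ * choose (+ N) a + + suc l * choosePred (+ N) a)
      ≡⟨ cong (σ * β *_) (choose-bracket-nonnegative μ N a l (suc (e ℕ.+ j)) s+N≡l+a) ⟩
    σ * β * ((μ + + a) * binom (+ N) (+ N - + a) + + suc (e ℕ.+ j) * binom (+ N) (+ N - + a + 1ℤ))
      ≡⟨ distribute σ β (μ + + a) _ (+ suc (e ℕ.+ j)) _ ⟩
    σ * (μ + + a) * β * binom (+ N) (+ N - + a) + σ * + suc (e ℕ.+ j) * β * binom (+ N) (+ N - + a + 1ℤ)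
      ≡⟨ cong (λ x → σ * (μ + + a) * β * binom x (x - + a) + σ * + suc (e ℕ.+ j) * β * binom x (x - + a + 1ℤ)) top≡N ⟨
    c₁Term j + c₂Term j ∎
    where
    σ = pow-1ℕ j
    β = + (M C (p ∸ j))
    N = d ∸ suc j
    top≡N : top j ≡ + N
    top≡N = m-n≡m∸n j<d
    s+N≡l+a : suc (e ℕ.+ j) ℕ.+ N ≡ l ℕ.+ a
    s+N≡l+a = trans (reassociate e j N) (trans (cong (e ℕ.+_) (ℕ.m+[n∸m]≡n j<d)) balance)
      where
      reassociate : ∀ e j n → suc (e ℕ.+ j) ℕ.+ n ≡ e ℕ.+ (suc j ℕ.+ n)
      reassociate = ℕ-Solver.solve-∀
    distribute : ∀ σ b c x s y → σ * b * (c * x + s * y) ≡ σ * c * b * x + σ * s * b * y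
    distribute = solve-∀

  lhsTerm-above : ∀ u → lhsTerm (d ℕ.+ u) ≡ c₁Term (d ℕ.+ u) + c₂Term (d ℕ.+ u) + extraTerm u
  lhsTerm-above u = begin
    σ * β * (μ * choose (top j) a + + suc l * choosePred (top j) a)
      ≡⟨ cong (λ x → σ * β * (μ * choose x a + + suc l * choosePred x a)) top≡-[1+u] ⟩
    σ * β * (μ * choose -[1+ u ] a + + suc l * choosePred -[1+ u ] a)
      ≡⟨ x*y*z≡y*[x*z] σ β _ ⟩
    β * (σ * (μ * choose -[1+ u ] a + + suc l * choosePred -[1+ u ] a))
      ≡⟨ cong (β *_) (choose-bracket-negative μ u a l d (suc (e ℕ.+ j)) s≡1+l+a+u) ⟩
    β * (σ * ((μ + + a) * binom -[1+ u ] (-[1+ u ] - + a) + + suc (e ℕ.+ j) * binom -[1+ u ] (-[1+ u ] - + a + 1ℤ)) + τ * E)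
      ≡⟨ distribute σ β (μ + + a) _ (+ suc (e ℕ.+ j)) _ τ E ⟩
    σ * (μ + + a) * β * binom -[1+ u ] (-[1+ u ] - + a) + σ * + suc (e ℕ.+ j) * β * binom -[1+ u ] (-[1+ u ] - + a + 1ℤ) + τ * β * E
      ≡⟨ cong (λ x → σ * (μ + + a) * β * binom x (x - + a) + σ * + suc (e ℕ.+ j) * β * binom x (x - + a + 1ℤ) + τ * β * E) top≡-[1+u] ⟨
    c₁Term j + c₂Term j + extraTerm u ∎
    where
    j = d ℕ.+ u
    σ = pow-1ℕ j
    β = + (M C (p ∸ j))
    E = μ * choose -[1+ a ] u - + suc l * choose (- + a) u
    top≡-[1+u] : top j ≡ -[1+ u ]
    top≡-[1+u] = trans (m-[1+n]≡-[1+n∸m] (ℕ.m≤m+n d u)) (cong -[1+_] (ℕ.m+n∸m≡n d u))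
    s≡1+l+a+u : suc (e ℕ.+ j) ≡ suc (l ℕ.+ a ℕ.+ u)
    s≡1+l+a+u = cong suc (trans (sym (ℕ.+-assoc e d u)) (cong (ℕ._+ u) balance))
    x*y*z≡y*[x*z] : ∀ x y z → x * y * z ≡ y * (x * z)
    x*y*z≡y*[x*z] = solve-∀
    distribute : ∀ σ b c x s y τ z → b * (σ * (c * x + s * y) + τ * z) ≡ σ * c * b * x + σ * s * b * y + τ * b * z
    distribute = solve-∀

  ∑-extraTerm-convolved : ∀ q → p ≡ d ℕ.+ q →
    ∑ (suc q) extraTerm ≡ τ * (μ * choose (+ M - + suc a) q - + suc l * choose (+ M - + a) q)
  ∑-extraTerm-convolved q p≡d+q = begin
    ∑ (suc q) extraTerm
      ≡⟨ ∑-cong (suc q) (λ {u} _ → trans (cong (λ n → τ * + (M C n) * E u) (p∸[d+u]≡q∸u u))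
                                         (separate τ (+ (M C (q ∸ u))) μ _ (+ suc l) _)) ⟩
    ∑[ u < suc q ] (τ * μ * (+ (M C (q ∸ u)) * choose -[1+ a ] u) + - (τ * + suc l) * (+ (M C (q ∸ u)) * choose (- + a) u))
      ≡⟨ ∑-distrib-+ (suc q) _ _ ⟩
    ∑[ u < suc q ] τ * μ * (+ (M C (q ∸ u)) * choose -[1+ a ] u) + ∑[ u < suc q ] - (τ * + suc l) * (+ (M C (q ∸ u)) * choose (- + a) u)
      ≡⟨ cong₂ _+_ (∑-distribˡ-* (suc q) (τ * μ) _) (∑-distribˡ-* (suc q) (- (τ * + suc l)) _) ⟩
    τ * μ * (∑[ u < suc q ] + (M C (q ∸ u)) * choose -[1+ a ] u) + - (τ * + suc l) * (∑[ u < suc q ] + (M C (q ∸ u)) * choose (- + a) u)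
      ≡⟨ cong₂ (λ x y → τ * μ * x + - (τ * + suc l) * y) (vandermondeʳ M -[1+ a ] q) (vandermondeʳ M (- + a) q) ⟩
    τ * μ * choose (+ M - + suc a) q + - (τ * + suc l) * choose (+ M - + a) q
      ≡⟨ collect τ μ _ (+ suc l) _ ⟩
    τ * (μ * choose (+ M - + suc a) q - + suc l * choose (+ M - + a) q) ∎
    where
    E : ℕ → ℤ
    E u = μ * choose -[1+ a ] u - + suc l * choose (- + a) u
    p∸[d+u]≡q∸u : ∀ u → p ∸ (d ℕ.+ u) ≡ q ∸ u
    p∸[d+u]≡q∸u u = trans (cong (_∸ (d ℕ.+ u)) p≡d+q) (ℕ.[m+n]∸[m+o]≡n∸o d q u)
    separate : ∀ τ b μ x ℓ y → τ * b * (μ * x - ℓ * y) ≡ τ * μ * (b * x) + - (τ * ℓ) * (b * y)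
    separate = solve-∀
    collect : ∀ τ μ x ℓ y → τ * μ * x + - (τ * ℓ) * y ≡ τ * (μ * x - ℓ * y)
    collect = solve-∀

  ∑-extraTerm : ∀ q → p ≡ d ℕ.+ q →
    ∑ (suc q) extraTerm ≡ pow-1ℕ (e ℕ.+ l) * (μ - + suc (l ℕ.+ q)) * + ((l ℕ.+ q) C l)
  ∑-extraTerm q p≡d+q = begin
    ∑ (suc q) extraTerm
      ≡⟨ ∑-extraTerm-convolved q p≡d+q ⟩
    τ * (μ * choose (+ M - + suc a) q - + suc l * choose (+ M - + a) q)
      ≡⟨ cong₂ (λ x y → τ * (μ * choose x q - + suc l * choose y q))
               (trans (cong (λ n → + n - + suc a) M≡l+q+[1+a]) (m+n-n≡m (l ℕ.+ q) (suc a)))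
               (trans (cong (λ n → + n - + a) M≡1+l+q+a) (m+n-n≡m (suc (l ℕ.+ q)) a)) ⟩
    τ * (μ * + ((l ℕ.+ q) C q) - + suc l * + (suc (l ℕ.+ q) C q))
      ≡⟨ cong₂ (λ x y → τ * (μ * + x - y)) (sym ([x+y]Cx≡[x+y]Cy l q)) absorption ⟩
    τ * (μ * + ((l ℕ.+ q) C l) - + suc (l ℕ.+ q) * + ((l ℕ.+ q) C l))
      ≡⟨ factor τ μ (+ suc (l ℕ.+ q)) _ ⟩
    τ * (μ - + suc (l ℕ.+ q)) * + ((l ℕ.+ q) C l)
      ≡⟨ cong (λ x → x * (μ - + suc (l ℕ.+ q)) * + ((l ℕ.+ q) C l)) (pow-1ℕ-parity {e} {d} {l} {a} balance) ⟨
    pow-1ℕ (e ℕ.+ l) * (μ - + suc (l ℕ.+ q)) * + ((l ℕ.+ q) C l) ∎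
    where
    M≡1+l+q+a : M ≡ suc (l ℕ.+ q) ℕ.+ a
    M≡1+l+q+a = cong suc (trans (cong (e ℕ.+_) p≡d+q) (trans (sym (ℕ.+-assoc e d q)) (trans (cong (ℕ._+ q) balance) (rearrange l a q))))
      where
      rearrange : ∀ l a q → l ℕ.+ a ℕ.+ q ≡ l ℕ.+ q ℕ.+ a
      rearrange = ℕ-Solver.solve-∀
    M≡l+q+[1+a] : M ≡ l ℕ.+ q ℕ.+ suc a
    M≡l+q+[1+a] = trans M≡1+l+q+a (sym (ℕ.+-suc (l ℕ.+ q) a))
    absorption : + suc l * + (suc (l ℕ.+ q) C q) ≡ + suc (l ℕ.+ q) * + ((l ℕ.+ q) C l)
    absorption = begin
      + suc l * + (suc (l ℕ.+ q) C q)          ≡⟨ cong (λ x → + suc l * + x) ([x+y]Cx≡[x+y]Cy (suc l) q) ⟨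
      + suc l * + (suc (l ℕ.+ q) C suc l)      ≡⟨ pos-* (suc l) _ ⟨
      + (suc l ℕ.* (suc (l ℕ.+ q) C suc l))    ≡⟨ cong +_ ([1+k]*[1+n]C[1+k]≡[1+n]*nCk (l ℕ.+ q) l) ⟩
      + (suc (l ℕ.+ q) ℕ.* ((l ℕ.+ q) C l))    ≡⟨ pos-* (suc (l ℕ.+ q)) _ ⟩
      + suc (l ℕ.+ q) * + ((l ℕ.+ q) C l)      ∎
    factor : ∀ τ μ s x → τ * (μ * x - s * x) ≡ τ * (μ - s) * x
    factor = solve-∀

  identity-below : p ℕ.< d → ∑ (suc a) lhsSummand ≡ ∑ (suc p) c₁Term + ∑ (suc p) c₂Term
  identity-below p<d = begin
    ∑ (suc a) lhsSummand                 ≡⟨ ∑-lhsSummand ⟩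
    ∑ (suc p) lhsTerm                    ≡⟨ ∑-cong (suc p) (λ j<1+p → lhsTerm-below (ℕ.<-≤-trans j<1+p p<d)) ⟩
    ∑[ j < suc p ] (c₁Term j + c₂Term j) ≡⟨ ∑-distrib-+ (suc p) c₁Term c₂Term ⟩
    ∑ (suc p) c₁Term + ∑ (suc p) c₂Term  ∎

  identity-above : ∀ q → p ≡ d ℕ.+ q → ∑ (suc a) lhsSummand
    ≡ ∑ (suc p) c₁Term + ∑ (suc p) c₂Term + pow-1ℕ (e ℕ.+ l) * (μ - + suc (l ℕ.+ q)) * + ((l ℕ.+ q) C l)
  identity-above q p≡d+q = begin
    ∑ (suc a) lhsSummand
      ≡⟨ ∑-lhsSummand ⟩
    ∑ (suc p) lhsTerm
      ≡⟨ cong (λ n → ∑ n lhsTerm) 1+p≡d+[1+q] ⟩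
    ∑ (d ℕ.+ suc q) lhsTerm
      ≡⟨ ∑-split d (suc q) lhsTerm ⟩
    ∑ d lhsTerm + ∑[ u < suc q ] lhsTerm (d ℕ.+ u)
      ≡⟨ cong₂ _+_ (∑-cong d lhsTerm-below) (∑-cong (suc q) (λ {u} _ → lhsTerm-above u)) ⟩
    ∑ d c₁₂ + ∑[ u < suc q ] (c₁₂ (d ℕ.+ u) + extraTerm u)
      ≡⟨ cong (λ x → ∑ d c₁₂ + x) (∑-distrib-+ (suc q) (λ u → c₁₂ (d ℕ.+ u)) extraTerm) ⟩
    ∑ d c₁₂ + (∑[ u < suc q ] c₁₂ (d ℕ.+ u) + ∑ (suc q) extraTerm)
      ≡⟨ +-assoc (∑ d c₁₂) _ _ ⟨
    ∑ d c₁₂ + ∑[ u < suc q ] c₁₂ (d ℕ.+ u) + ∑ (suc q) extraTerm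
      ≡⟨ cong (_+ ∑ (suc q) extraTerm) (trans (sym (∑-split d (suc q) c₁₂)) (cong (λ n → ∑ n c₁₂) (sym 1+p≡d+[1+q]))) ⟩
    ∑ (suc p) c₁₂ + ∑ (suc q) extraTerm
      ≡⟨ cong₂ _+_ (∑-distrib-+ (suc p) c₁Term c₂Term) (∑-extraTerm q p≡d+q) ⟩
    ∑ (suc p) c₁Term + ∑ (suc p) c₂Term + pow-1ℕ (e ℕ.+ l) * (μ - + suc (l ℕ.+ q)) * + ((l ℕ.+ q) C l) ∎
    where
    c₁₂ : ℕ → ℤ
    c₁₂ j = c₁Term j + c₂Term j
    1+p≡d+[1+q] : suc p ≡ d ℕ.+ suc q
    1+p≡d+[1+q] = trans (cong suc p≡d+q) (sym (ℕ.+-suc d q))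
module NaturalParameters (n c i l m : ℤ) {a e p d L ii : ℕ}
  (c-m-1≡a : c - m - 1ℤ ≡ + a) (n+c-m-1≡e : n + c - m - 1ℤ ≡ + e) (i-[n+1]≡p : i - (n + 1ℤ) ≡ + p)
  (l-n≡d : l - n ≡ + d) (l≡L : l ≡ + L) (i-1≡ii : i - 1ℤ ≡ + ii) where

  balance : e ℕ.+ d ≡ L ℕ.+ a
  balance = +-injective (begin
    + (e ℕ.+ d)                           ≡⟨ pos-+ e d ⟩
    + e + + d                             ≡⟨ cong₂ _+_ n+c-m-1≡e l-n≡d ⟨
    n + c - m - 1ℤ + (l - n)              ≡⟨ regroup n c m l ⟩
    l + (c - m - 1ℤ)                      ≡⟨ cong₂ _+_ l≡L c-m-1≡a ⟩
    + L + + a                             ≡⟨ pos-+ L a ⟨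
    + (L ℕ.+ a)                           ∎)
    where
    regroup : ∀ n c m l → n + c - m - 1ℤ + (l - n) ≡ l + (c - m - 1ℤ)
    regroup = solve-∀

  a≤e+p : a ℕ.≤ e ℕ.+ p
  a≤e+p = subst (a ℕ.≤_) (+-injective (begin
    + (a ℕ.+ ii)                          ≡⟨ pos-+ a ii ⟩
    + a + + ii                            ≡⟨ cong₂ _+_ c-m-1≡a i-1≡ii ⟨
    c - m - 1ℤ + (i - 1ℤ)                 ≡⟨ regroup n c m i ⟩
    n + c - m - 1ℤ + (i - (n + 1ℤ))       ≡⟨ cong₂ _+_ n+c-m-1≡e i-[n+1]≡p ⟩
    + e + + p                             ≡⟨ pos-+ e p ⟨
    + (e ℕ.+ p)                           ∎)) (ℕ.m≤m+n a ii)
    where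
    regroup : ∀ n c m i → c - m - 1ℤ + (i - 1ℤ) ≡ n + c - m - 1ℤ + (i - (n + 1ℤ))
    regroup = solve-∀

  open Identity e a p d L (m + 1ℤ) balance a≤e+p public

  top-M : c - m - + 1 + i ≡ + M
  top-M = begin
    c - m - + 1 + i                               ≡⟨ regroup n c m i ⟩
    1ℤ + (n + c - m - 1ℤ + (i - (n + 1ℤ)))         ≡⟨ cong (λ x → 1ℤ + x) (trans (cong₂ _+_ n+c-m-1≡e i-[n+1]≡p) (sym (pos-+ e p))) ⟩
    + M                                           ∎
    where
    regroup : ∀ n c m i → c - m - + 1 + i ≡ 1ℤ + (n + c - m - 1ℤ + (i - (n + 1ℤ)))
    regroup = solve-∀

  c-k : ∀ {k} → k ℕ.≤ a → c - + k ≡ m + 1ℤ + + (a ∸ k)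
  c-k {k} k≤a = begin
    c - + k                         ≡⟨ regroup c m (+ k) ⟩
    m + 1ℤ + (c - m - 1ℤ - + k)     ≡⟨ cong (λ x → m + 1ℤ + (x - + k)) c-m-1≡a ⟩
    m + 1ℤ + (+ a - + k)            ≡⟨ cong (λ x → m + 1ℤ + x) (m-n≡m∸n k≤a) ⟩
    m + 1ℤ + + (a ∸ k)              ∎
    where
    regroup : ∀ c m k → c - k ≡ m + 1ℤ + (c - m - 1ℤ - k)
    regroup = solve-∀
  top₂ : ∀ {k} → k ℕ.≤ a → c - m - + 2 + i - + k ≡ + (e ℕ.+ p ∸ k)
  top₂ {k} k≤a = begin
    c - m - + 2 + i - + k                        ≡⟨ regroup n c m i (+ k) ⟩
    n + c - m - 1ℤ + (i - (n + 1ℤ)) - + k        ≡⟨ cong (_- + k) (trans (cong₂ _+_ n+c-m-1≡e i-[n+1]≡p) (sym (pos-+ e p))) ⟩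
    + (e ℕ.+ p) - + k                            ≡⟨ m-n≡m∸n (ℕ.≤-trans k≤a a≤e+p) ⟩
    + (e ℕ.+ p ∸ k)                              ∎
    where
    regroup : ∀ n c m i k → c - m - + 2 + i - k ≡ n + c - m - 1ℤ + (i - (n + 1ℤ)) - k
    regroup = solve-∀
  top₃ : ∀ {k} → k ℕ.≤ a → l + c - m - + 1 - + k ≡ + (L ℕ.+ (a ∸ k))
  top₃ {k} k≤a = begin
    l + c - m - + 1 - + k                        ≡⟨ regroup l c m (+ k) ⟩
    l + (c - m - 1ℤ - + k)                       ≡⟨ cong₂ (λ x y → x + (y - + k)) l≡L c-m-1≡a ⟩
    + L + (+ a - + k)                            ≡⟨ cong (λ x → + L + x) (m-n≡m∸n k≤a) ⟩
    + L + + (a ∸ k)                              ≡⟨ pos-+ L (a ∸ k) ⟨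
    + (L ℕ.+ (a ∸ k))                            ∎
    where
    regroup : ∀ l c m k → l + c - m - + 1 - k ≡ l + (c - m - 1ℤ - k)
    regroup = solve-∀

  LHS≡ : LHS n c i l m ≡ ∑ (suc a) lhsSummand
  LHS≡ = begin
    sum0to (c - m - + 1) summand      ≡⟨ cong (λ x → sum0to x summand) c-m-1≡a ⟩
    sumℕ (suc a) summand              ≡⟨ sumℕ≡∑ (suc a) summand ⟩
    ∑[ k < suc a ] summand (+ k)      ≡⟨ ∑-cong (suc a) (λ k<1+a → summand≡ (ℕ.≤-pred k<1+a)) ⟩
    ∑ (suc a) lhsSummand              ∎
    where
    summand : ℤ → ℤ
    summand k = sgn k * (c - k) * binom (c - m - + 1 + i) k
      * binom (c - m - + 2 + i - k) (i - (n + + 1))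
      * binom (l + c - m - + 1 - k) l
    summand≡ : ∀ {k} → k ℕ.≤ a → summand (+ k) ≡ lhsSummand k
    summand≡ {k} k≤a = cong₂ _*_ (cong₂ _*_ (cong₂ (λ x y → sgn (+ k) * x * binom y (+ k)) (c-k k≤a) top-M)
                                             (cong₂ binom (top₂ k≤a) i-[n+1]≡p))
                                 (cong₂ binom (top₃ k≤a) l≡L)

  p-j : ∀ {j} → j ℕ.≤ p → i - (n + + 1 + + j) ≡ + (p ∸ j)
  p-j {j} j≤p = begin
    i - (n + + 1 + + j)        ≡⟨ regroup i n (+ j) ⟩
    i - (n + 1ℤ) - + j         ≡⟨ cong (_- + j) i-[n+1]≡p ⟩
    + p - + j                  ≡⟨ m-n≡m∸n j≤p ⟩
    + (p ∸ j)                  ∎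
    where
    regroup : ∀ i n j → i - (n + + 1 + j) ≡ i - (n + 1ℤ) - j
    regroup = solve-∀

  top-j : ∀ j → l - (n + + 1 + + j) ≡ top j
  top-j j = trans (regroup l n (+ j)) (cong (_- (1ℤ + + j)) l-n≡d)
    where
    regroup : ∀ l n j → l - (n + + 1 + j) ≡ l - n - (1ℤ + j)
    regroup = solve-∀

  top-j-a : ∀ j → l - (n + c - m + + j) ≡ top j - + a
  top-j-a j = trans (regroup l n c m (+ j)) (cong₂ (λ x y → x - (1ℤ + + j) - y) l-n≡d c-m-1≡a)
    where
    regroup : ∀ l n c m j → l - (n + c - m + j) ≡ l - n - (1ℤ + j) - (c - m - 1ℤ)
    regroup = solve-∀

  top-j-a+1 : ∀ j → l - (n + c - m - + 1 + + j) ≡ top j - + a + 1ℤ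
  top-j-a+1 j = trans (regroup l n c m (+ j)) (cong₂ (λ x y → x - (1ℤ + + j) - y + 1ℤ) l-n≡d c-m-1≡a)
    where
    regroup : ∀ l n c m j → l - (n + c - m - + 1 + j) ≡ l - n - (1ℤ + j) - (c - m - 1ℤ) + 1ℤ
    regroup = solve-∀

  c≡μ+a : c ≡ m + 1ℤ + + a
  c≡μ+a = trans (regroup c m) (cong (λ x → m + 1ℤ + x) c-m-1≡a)
    where
    regroup : ∀ c m → c ≡ m + 1ℤ + (c - m - 1ℤ)
    regroup = solve-∀

  n+c-m+j : ∀ j → n + c - m + + j ≡ + suc (e ℕ.+ j)
  n+c-m+j j = trans (regroup n c m (+ j)) (cong (λ x → 1ℤ + x) (trans (cong (_+ + j) n+c-m-1≡e) (sym (pos-+ e j))))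
    where
    regroup : ∀ n c m j → n + c - m + j ≡ 1ℤ + (n + c - m - 1ℤ + j)
    regroup = solve-∀

  C₁≡ : C₁ n c i l m ≡ ∑ (suc p) c₁Term
  C₁≡ = begin
    sum0to ((i - (n + + 1)) ⊓ (l - (n + c - m))) summand  ≡⟨ cong (λ x → sum0to (x ⊓ (l - (n + c - m))) summand) i-[n+1]≡p ⟩
    sum0to (+ p ⊓ (l - (n + c - m))) summand              ≡⟨ sum0to-⊓ p _ summand vanishes ⟩
    ∑[ j < suc p ] summand (+ j)                          ≡⟨ ∑-cong (suc p) (λ j<1+p → summand≡ (ℕ.≤-pred j<1+p)) ⟩
    ∑ (suc p) c₁Term                                      ∎
    where
    factor : ℤ → ℤ
    factor j = sgn j * c * binom (c - m - + 1 + i) (i - (n + + 1 + j))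
    summand : ℤ → ℤ
    summand j = factor j * binom (l - (n + + 1 + j)) (l - (n + c - m + j))
    vanishes : ∀ j → l - (n + c - m) < + j → summand (+ j) ≡ 0ℤ
    vanishes j lt = begin
      factor (+ j) * binom (l - (n + + 1 + + j)) (l - (n + c - m + + j))   ≡⟨ cong (λ y → factor (+ j) * binom _ y) (regroup l n c m (+ j)) ⟩
      factor (+ j) * binom (l - (n + + 1 + + j)) (l - (n + c - m) - + j)   ≡⟨ cong (factor (+ j) *_) (binom-below _ j lt) ⟩
      factor (+ j) * 0ℤ                                                    ≡⟨ *-zeroʳ (factor (+ j)) ⟩
      0ℤ                                                                   ∎
      where
      regroup : ∀ l n c m j → l - (n + c - m + j) ≡ l - (n + c - m) - j
      regroup = solve-∀
    summand≡ : ∀ {j} → j ℕ.≤ p → summand (+ j) ≡ c₁Term j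
    summand≡ {j} j≤p = cong₂ _*_ (cong₂ (λ x y → sgn (+ j) * x * y) c≡μ+a (cong₂ binom top-M (p-j j≤p)))
                                 (cong₂ binom (top-j j) (top-j-a j))

  C₂≡ : C₂ n c i l m ≡ ∑ (suc p) c₂Term
  C₂≡ = begin
    sum0to ((i - (n + + 1)) ⊓ (l - (n + c - m - + 1))) summand  ≡⟨ cong (λ x → sum0to (x ⊓ (l - (n + c - m - + 1))) summand) i-[n+1]≡p ⟩
    sum0to (+ p ⊓ (l - (n + c - m - + 1))) summand              ≡⟨ sum0to-⊓ p _ summand vanishes ⟩
    ∑[ j < suc p ] summand (+ j)                                ≡⟨ ∑-cong (suc p) (λ j<1+p → summand≡ (ℕ.≤-pred j<1+p)) ⟩
    ∑ (suc p) c₂Term                                            ∎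
    where
    factor : ℤ → ℤ
    factor j = sgn j * (n + c - m + j) * binom (c - m - + 1 + i) (i - (n + + 1 + j))
    summand : ℤ → ℤ
    summand j = factor j * binom (l - (n + + 1 + j)) (l - (n + c - m - + 1 + j))
    vanishes : ∀ j → l - (n + c - m - + 1) < + j → summand (+ j) ≡ 0ℤ
    vanishes j lt = begin
      factor (+ j) * binom (l - (n + + 1 + + j)) (l - (n + c - m - + 1 + + j))   ≡⟨ cong (λ y → factor (+ j) * binom _ y) (regroup l n c m (+ j)) ⟩
      factor (+ j) * binom (l - (n + + 1 + + j)) (l - (n + c - m - + 1) - + j)   ≡⟨ cong (factor (+ j) *_) (binom-below _ j lt) ⟩
      factor (+ j) * 0ℤ                                                          ≡⟨ *-zeroʳ (factor (+ j)) ⟩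
      0ℤ                                                                         ∎
      where
      regroup : ∀ l n c m j → l - (n + c - m - + 1 + j) ≡ l - (n + c - m - + 1) - j
      regroup = solve-∀
    summand≡ : ∀ {j} → j ℕ.≤ p → summand (+ j) ≡ c₂Term j
    summand≡ {j} j≤p = cong₂ _*_ (cong₂ (λ x y → sgn (+ j) * x * y) (n+c-m+j j) (cong₂ binom top-M (p-j j≤p)))
                                 (cong₂ binom (top-j j) (top-j-a+1 j))

  extra≡ : ∀ q → p ≡ d ℕ.+ q →
    sgn (n + c - m - + 1 + l) * (m + + 1 - i) * binom (i - + 1) l
    ≡ pow-1ℕ (e ℕ.+ L) * (m + 1ℤ - + suc (L ℕ.+ q)) * + ((L ℕ.+ q) C L)
  extra≡ q p≡d+q = begin
    sgn (n + c - m - + 1 + l) * (m + + 1 - i) * binom (i - + 1) l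
      ≡⟨ cong₂ (λ x y → sgn x * y * binom (i - + 1) l) e+L m+1-i ⟩
    pow-1ℕ (e ℕ.+ L) * (m + 1ℤ - (1ℤ + (i - + 1))) * binom (i - + 1) l
      ≡⟨ cong₂ (λ x y → pow-1ℕ (e ℕ.+ L) * (m + 1ℤ - (1ℤ + x)) * binom x y) i-1≡L+q l≡L ⟩
    pow-1ℕ (e ℕ.+ L) * (m + 1ℤ - + suc (L ℕ.+ q)) * + ((L ℕ.+ q) C L) ∎
    where
    i-1≡L+q : i - + 1 ≡ + (L ℕ.+ q)
    i-1≡L+q = begin
      i - + 1                         ≡⟨ regroup i n l ⟩
      i - (n + 1ℤ) - (l - n) + l      ≡⟨ cong₃ i-[n+1]≡p l-n≡d l≡L ⟩
      + p - + d + + L                 ≡⟨ cong (λ x → + x - + d + + L) p≡d+q ⟩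
      + (d ℕ.+ q) - + d + + L         ≡⟨ cong (λ x → x - + d + + L) (pos-+ d q) ⟩
      + d + + q - + d + + L           ≡⟨ cancel (+ d) (+ q) (+ L) ⟩
      + L + + q                       ≡⟨ pos-+ L q ⟨
      + (L ℕ.+ q)                     ∎
      where
      regroup : ∀ i n l → i - + 1 ≡ i - (n + 1ℤ) - (l - n) + l
      regroup = solve-∀
      cong₃ : ∀ {x x′ y y′ z z′} → x ≡ x′ → y ≡ y′ → z ≡ z′ → x - y + z ≡ x′ - y′ + z′
      cong₃ refl refl refl = refl
      cancel : ∀ d q l → d + q - d + l ≡ l + q
      cancel = solve-∀
    m+1-i : m + + 1 - i ≡ m + 1ℤ - (1ℤ + (i - + 1))
    m+1-i = regroup m i
      where
      regroup : ∀ m i → m + + 1 - i ≡ m + 1ℤ - (1ℤ + (i - + 1))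
      regroup = solve-∀
    e+L : n + c - m - + 1 + l ≡ + (e ℕ.+ L)
    e+L = trans (cong₂ _+_ n+c-m-1≡e l≡L) (sym (pos-+ e L))

  i≤l⇒p<d : i ≤ l → p ℕ.< d
  i≤l⇒p<d i≤l = drop‿+≤+ (0≤i-j⇒j≤i (subst (0ℤ ≤_) l-i≡d-[1+p] (i≤j⇒0≤j-i i≤l)))
    where
    l-i≡d-[1+p] : l - i ≡ + d - + suc p
    l-i≡d-[1+p] = trans (regroup l i n) (cong₂ (λ x y → x - (1ℤ + y)) l-n≡d i-[n+1]≡p)
      where
      regroup : ∀ l i n → l - i ≡ l - n - (1ℤ + (i - (n + 1ℤ)))
      regroup = solve-∀

  l≤i-1⇒p≡d+[p∸d] : l ≤ i - + 1 → p ≡ d ℕ.+ (p ∸ d)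
  l≤i-1⇒p≡d+[p∸d] l≤i-1 = sym (ℕ.m+[n∸m]≡n {d} (drop‿+≤+ (0≤i-j⇒j≤i (subst (0ℤ ≤_) i-1-l≡p-d (i≤j⇒0≤j-i l≤i-1)))))
    where
    i-1-l≡p-d : i - + 1 - l ≡ + p - + d
    i-1-l≡p-d = trans (regroup i l n) (cong₂ _-_ i-[n+1]≡p l-n≡d)
      where
      regroup : ∀ i l n → i - + 1 - l ≡ i - (n + 1ℤ) - (l - n)
      regroup = solve-∀

lemmaA3 : (n c i l m : ℤ) →
    (+ 0 ⊔ n) ≤ l → (+ 1 ⊔ (n + + 1)) ≤ i → + 1 ≤ m → m ≤ c - + 1 →
    + 0 ≤ n + c - m - + 1 →
    ((i ≤ l → LHS n c i l m ≡ C₁ n c i l m + C₂ n c i l m)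
    × (l ≤ i - + 1 → LHS n c i l m ≡ C₁ n c i l m + C₂ n c i l m
          + sgn (n + c - m - + 1 + l) * (m + + 1 - i) * binom (i - + 1) l)
    × (l < n + c - m → C₁ n c i l m ≡ + 0)
    × (l < n + c - m - + 1 → C₂ n c i l m ≡ + 0))
lemmaA3 n c i l m 0⊔n≤l 1⊔[n+1]≤i _ m≤c-1 0≤e =
    (λ i≤l → trans LHS≡ (trans (identity-below (i≤l⇒p<d i≤l)) (sym (cong₂ _+_ C₁≡ C₂≡))))
  , (λ l≤i-1 → trans LHS≡ (trans (identity-above _ (l≤i-1⇒p≡d+[p∸d] l≤i-1))
                                 (sym (cong₂ _+_ (cong₂ _+_ C₁≡ C₂≡) (extra≡ _ (l≤i-1⇒p≡d+[p∸d] l≤i-1))))))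
  , (λ l<n+c-m → sum0to-⊓-below (i - (n + + 1)) _ l<n+c-m)
  , (λ l<n+c-m-1 → sum0to-⊓-below (i - (n + + 1)) _ l<n+c-m-1)
  where
  as-ℕ : ∀ {x} → 0ℤ ≤ x → x ≡ + ∣ x ∣
  as-ℕ 0≤x = sym (0≤i⇒+∣i∣≡i 0≤x)
  0≤c-m-1 : 0ℤ ≤ c - m - 1ℤ
  0≤c-m-1 = subst (0ℤ ≤_) (regroup c m) (i≤j⇒0≤j-i m≤c-1)
    where
    regroup : ∀ c m → c - 1ℤ - m ≡ c - m - 1ℤ
    regroup = solve-∀
  open NaturalParameters n c i l m (as-ℕ 0≤c-m-1) (as-ℕ 0≤e) (as-ℕ (i≤j⇒0≤j-i (i⊔j≤k⇒j≤k (+ 1) (n + + 1) 1⊔[n+1]≤i)))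
    (as-ℕ (i≤j⇒0≤j-i (i⊔j≤k⇒j≤k (+ 0) n 0⊔n≤l))) (as-ℕ (i⊔j≤k⇒i≤k (+ 0) n 0⊔n≤l))
    (as-ℕ (i≤j⇒0≤j-i (i⊔j≤k⇒i≤k (+ 1) (n + + 1) 1⊔[n+1]≤i)))
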